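{- Let $B\ge 2$ and $D=1+i$. For every positive integer $m$ there exists a $D$-consecutive sequence of $m$ Gaussian $B$-happy numbers.
   Context: Fix an integer $B\ge 2$. Every nonzero Gaussian integer $a+bi$ is written uniquely as $a+bi=\sum_{j=0}^n (a_j+b_ji)B^j$ with $a_j,b_j\in\mathbb{Z}$, $a_n,b_n$ not both $0$, and for each $j$: $|a_j|\le B-1$, $|b_j|\le B-1$, $\operatorname{sgn}(a)a_j\ge 0$, $\operatorname{sgn}(b)b_j\ge 0$. The Gaussian $B$-happy function $S_B:\mathbb{Z}[i]\to\mathbb{Z}[i]$ is defined by $S_B(0)=0$ and $S_B(a+bi)=\sum_{j=0}^n (a_j+b_ji)^2$. A Gaussian integer $z$ is Gaussian $B$-happy if $S_B^k(z)=1$ for some $k\ge1$. For $D\in\mathbb{Z}[i]\setminus\{0\}$, a $D$-consecutive sequence of length $m$ is a sequence $z,z+D,\dots,z+(m-1)D$ with $z\in\mathbb{Z}[i]$. -}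

module Defs where

open import Data.Nat as ℕ using (ℕ; zero; suc; NonZero; _≥_)
open import Data.Nat.DivMod using (_/_; _%_)
open import Data.Integer as ℤ using (ℤ; +_; -[1+_]; ∣_∣; sign)
open import Data.Sign as Sign using (Sign)
open import Data.List using (List; []; _∷_; sum; map; zipWith)
open import Data.Product using (_×_; _,_; proj₁; proj₂; ∃-syntax; Σ-syntax)
open import Relation.Binary.PropositionalEquality using (_≡_)

ℤ[i] : Set
ℤ[i] = ℤ × ℤ

_+ᵍ_ : ℤ[i] → ℤ[i] → ℤ[i]
(a , b) +ᵍ (c , d) = (a ℤ.+ c , b ℤ.+ d)

_*ᵍ_ : ℤ[i] → ℤ[i] → ℤ[i]
(a , b) *ᵍ (c , d) = (a ℤ.* c ℤ.- b ℤ.* d , a ℤ.* d ℤ.+ b ℤ.* c)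

_·ᵍ_ : ℕ → ℤ[i] → ℤ[i]
k ·ᵍ (a , b) = (+ k ℤ.* a , + k ℤ.* b)

oneᵍ : ℤ[i]
oneᵍ = (+ 1 , + 0)

-- base-B digits of a natural number, least significant first.
-- 'fuel' is a recursion bound; n itself is always enough fuel (since B ≥ 2).
digitsFuel : (B : ℕ) → .{{_ : NonZero B}} → ℕ → ℕ → List ℕ
digitsFuel B zero    n = []
digitsFuel B (suc f) zero = []
digitsFuel B (suc f) n@(suc _) = (n % B) ∷ digitsFuel B f (n / B)

digits : (B : ℕ) → .{{_ : NonZero B}} → ℕ → List ℕ
digits B n = digitsFuel B n n

-- Signed base-B digits of an integer a: the digits a_j with |a_j| ≤ B-1 and
-- sgn(a) a_j ≥ 0, i.e. the base-B digits of |a| carrying the sign of a.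
signedDigits : (B : ℕ) → .{{_ : NonZero B}} → ℤ → List ℤ
signedDigits B a = map (λ d → sign a ℤ.◃ d) (digits B ∣ a ∣)

zipPad : List ℤ → List ℤ → List ℤ[i]
zipPad []       []       = []
zipPad []       (b ∷ bs) = (+ 0 , b) ∷ zipPad [] bs
zipPad (a ∷ as) []       = (a , + 0) ∷ zipPad as []
zipPad (a ∷ as) (b ∷ bs) = (a , b) ∷ zipPad as bs

gaussDigits : (B : ℕ) → .{{_ : NonZero B}} → ℤ[i] → List ℤ[i]
gaussDigits B (a , b) = zipPad (signedDigits B a) (signedDigits B b)

sumᵍ : List ℤ[i] → ℤ[i]
sumᵍ []       = (+ 0 , + 0)
sumᵍ (z ∷ zs) = z +ᵍ sumᵍ zs

-- The Gaussian B-happy function S_B (S_B(0) = 0 since 0 has no digits).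
S : (B : ℕ) → .{{_ : NonZero B}} → ℤ[i] → ℤ[i]
S B z = sumᵍ (map (λ d → d *ᵍ d) (gaussDigits B z))

iter : {A : Set} → (A → A) → ℕ → A → A
iter f zero    x = x
iter f (suc k) x = f (iter f k x)

GaussHappy : (B : ℕ) → .{{_ : NonZero B}} → ℤ[i] → Set
GaussHappy B z = ∃[ k ] (iter (S B) (suc k) z ≡ oneᵍ)

-- Say that a list U of Gaussian integers has a happy translate if some a + bi with b even makes
-- S(a + bi) + u happy for every u ∈ U. For z = B^m (a + bi) the digits of z + j(1 + i), j < m, are
-- those of j + ji followed by those of a + bi, so S(z + j(1 + i)) = S(a + bi) + S(j + ji): it suffices
-- to find a happy translate of U = [S(j + ji) | j < m]. A singleton has one, because every x + 2yi
-- with y ≥ 0 is a value of S and S(a′ + 2Wi) = 1 for some a′ and arbitrarily large W. Two elements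
-- u₁, u₂ of U are merged using maps f u = S(u + c) where c has large digits: a happy translate of
-- f[U] lifts to one of U, and f u₂ - f u₁ can be made any S t - S s with t - s = u₂ - u₁ and s, t
-- small. Suitable s, t move u₂ - u₁ from the fourth quadrant to the first, then to the real axis,
-- then to a real multiple of B - 1, and finally to 0. Throughout, imaginary parts stay even and, for
-- odd B, real parts stay congruent mod 2.

module Submission where

open import Defs
open import Data.Nat as ℕ using (ℕ; zero; suc; NonZero; _≥_; _<_; _≤_; z≤n; s≤s; _^_; _+_; _*_; _∸_)
import Data.Nat.Properties as ℕ
open import Data.Nat.DivMod
open import Data.Nat.Divisibility using (divides-refl)
open import Data.Nat.Induction using (<-rec)
open import Data.Nat.ListAction using (sum)
import Data.Nat.Tactic.RingSolver as ℕ-Solver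
open import Data.Integer as ℤ using (ℤ; +_; -[1+_]; ∣_∣)
import Data.Integer.Properties as ℤ
open import Data.Integer.Tactic.RingSolver using (solve-∀)
open import Data.List using (List; []; _∷_; _++_; length; map; zipWith; drop; replicate; upTo)
import Data.List.Properties as List
open import Data.List.Relation.Unary.All as All using (All; []; _∷_)
import Data.List.Relation.Unary.All.Properties as All
open import Data.List.Relation.Unary.Any using (here; there)
open import Data.List.Membership.Propositional using (_∈_)
open import Data.List.Membership.Propositional.Properties using (∈-map⁺; ∈-map⁻; ∈-upTo⁺)
open import Data.Product using (_×_; _,_; proj₁; proj₂; uncurry; ∃-syntax)
open import Data.Sum using (_⊎_; inj₁; inj₂)
open import Data.Empty using (⊥-elim)
open import Function using (id; _∘_)
open import Relation.Binary.PropositionalEquality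

⟨_,_⟩ : ℕ → ℕ → ℤ[i]
⟨ a , b ⟩ = (+ a , + b)

0ᵍ : ℤ[i]
0ᵍ = (+ 0 , + 0)

infixl 6 _-ᵍ_
_-ᵍ_ : ℤ[i] → ℤ[i] → ℤ[i]
(a , b) -ᵍ (c , d) = (a ℤ.- c , b ℤ.- d)

-ᵍ_ : ℤ[i] → ℤ[i]
-ᵍ (a , b) = (ℤ.- a , ℤ.- b)

sq : ℤ[i] → ℤ[i]
sq z = z *ᵍ z

+ᵍ-identityˡ : ∀ z → 0ᵍ +ᵍ z ≡ z
+ᵍ-identityˡ (a , b) = cong₂ _,_ (ℤ.+-identityˡ a) (ℤ.+-identityˡ b)

+ᵍ-identityʳ : ∀ z → z +ᵍ 0ᵍ ≡ z
+ᵍ-identityʳ (a , b) = cong₂ _,_ (ℤ.+-identityʳ a) (ℤ.+-identityʳ b)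

+ᵍ-comm : ∀ z w → z +ᵍ w ≡ w +ᵍ z
+ᵍ-comm (a , b) (c , d) = cong₂ _,_ (ℤ.+-comm a c) (ℤ.+-comm b d)

+ᵍ-assoc : ∀ z w v → (z +ᵍ w) +ᵍ v ≡ z +ᵍ (w +ᵍ v)
+ᵍ-assoc (a , b) (c , d) (e , f) = cong₂ _,_ (ℤ.+-assoc a c e) (ℤ.+-assoc b d f)

+ᵍ-left-comm : ∀ z w v → z +ᵍ (w +ᵍ v) ≡ w +ᵍ (z +ᵍ v)
+ᵍ-left-comm z w v = trans (sym (+ᵍ-assoc z w v)) (trans (cong (_+ᵍ v) (+ᵍ-comm z w)) (+ᵍ-assoc w z v))

[z-w]+w≡z : ∀ z w → (z -ᵍ w) +ᵍ w ≡ z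
[z-w]+w≡z (a , b) (c , d) = cong₂ _,_ (lemma a c) (lemma b d)
  where
  lemma : ∀ a c → (a ℤ.- c) ℤ.+ c ≡ a
  lemma = solve-∀

z-z≡0 : ∀ z → z -ᵍ z ≡ 0ᵍ
z-z≡0 (a , b) = cong₂ _,_ (ℤ.+-inverseʳ a) (ℤ.+-inverseʳ b)

[c+t]-[c+s]≡t-s : ∀ c s t → (c +ᵍ t) -ᵍ (c +ᵍ s) ≡ t -ᵍ s
[c+t]-[c+s]≡t-s (a , b) (c , d) (e , f) = cong₂ _,_ (lemma a c e) (lemma b d f)
  where
  lemma : ∀ a c e → (a ℤ.+ e) ℤ.- (a ℤ.+ c) ≡ e ℤ.- c
  lemma = solve-∀

z-w≡0⇒z≡w : ∀ z w → z -ᵍ w ≡ 0ᵍ → z ≡ w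
z-w≡0⇒z≡w (a , b) (c , d) eq =
  cong₂ _,_ (ℤ.i-j≡0⇒i≡j a c (cong proj₁ eq)) (ℤ.i-j≡0⇒i≡j b d (cong proj₂ eq))

z-w≡-[w-z] : ∀ z w → z -ᵍ w ≡ -ᵍ (w -ᵍ z)
z-w≡-[w-z] (a , b) (c , d) = cong₂ _,_ (lemma a c) (lemma b d)
  where
  lemma : ∀ a c → a ℤ.- c ≡ ℤ.- (c ℤ.- a)
  lemma = solve-∀

⟨⟩+ᵍ⟨⟩ : ∀ a b c d → ⟨ a , b ⟩ +ᵍ ⟨ c , d ⟩ ≡ ⟨ a + c , b + d ⟩
⟨⟩+ᵍ⟨⟩ a b c d = cong₂ _,_ (sym (ℤ.pos-+ a c)) (sym (ℤ.pos-+ b d))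

[z+c]-[w+c]≡z-w : ∀ z w c → (z +ᵍ c) -ᵍ (w +ᵍ c) ≡ z -ᵍ w
[z+c]-[w+c]≡z-w (a , b) (c , d) (e , f) = cong₂ _,_ (lemma a c e) (lemma b d f)
  where
  lemma : ∀ a c e → (a ℤ.+ e) ℤ.- (c ℤ.+ e) ≡ a ℤ.- c
  lemma = solve-∀

translate-diff : ∀ u u₀ s t p → u -ᵍ u₀ ≡ t -ᵍ s → u +ᵍ ((s +ᵍ p) -ᵍ u₀) ≡ t +ᵍ p
translate-diff (a , b) (a₀ , b₀) (s , s′) (t , t′) (p , p′) eq =
  cong₂ _,_ (lemma a a₀ s t p (cong proj₁ eq)) (lemma b b₀ s′ t′ p′ (cong proj₂ eq))
  where
  lemma : ∀ a a₀ s t p → a ℤ.- a₀ ≡ t ℤ.- s → a ℤ.+ ((s ℤ.+ p) ℤ.- a₀) ≡ t ℤ.+ p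
  lemma a a₀ s t p eq = trans (regroup a a₀ s p) (trans (cong (λ d → d ℤ.+ s ℤ.+ p) eq) (cancel t s p))
    where
    regroup : ∀ a a₀ s p → a ℤ.+ ((s ℤ.+ p) ℤ.- a₀) ≡ (a ℤ.- a₀) ℤ.+ s ℤ.+ p
    regroup = solve-∀
    cancel : ∀ t s p → (t ℤ.- s) ℤ.+ s ℤ.+ p ≡ t ℤ.+ p
    cancel = solve-∀

Even : ℕ → Set
Even n = ∃[ k ] n ≡ k + k

Odd : ℕ → Set
Odd n = ∃[ k ] n ≡ suc (k + k)

even-or-odd : ∀ n → Even n ⊎ Odd n
even-or-odd zero = inj₁ (0 , refl)
even-or-odd (suc n) with even-or-odd n
... | inj₁ (k , n≡2k) = inj₂ (k , cong suc n≡2k)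
... | inj₂ (k , n≡2k+1) = inj₁ (suc k , cong suc (trans n≡2k+1 (sym (ℕ.+-suc k k))))

n*n+n-even : ∀ n → Even (n * n + n)
n*n+n-even zero = 0 , refl
n*n+n-even (suc n) with n*n+n-even n
... | k , eq = suc (k + n) , (begin
    suc n * suc n + suc n            ≡⟨ expand n ⟩
    (n * n + n) + suc n + suc n      ≡⟨ cong (λ t → t + suc n + suc n) eq ⟩
    k + k + suc n + suc n            ≡⟨ regroup k n ⟩
    suc (k + n) + suc (k + n)        ∎)
  where
  open ≡-Reasoning
  expand : ∀ n → suc n * suc n + suc n ≡ (n * n + n) + suc n + suc n
  expand = ℕ-Solver.solve-∀
  regroup : ∀ k n → k + k + suc n + suc n ≡ suc (k + n) + suc (k + n)
  regroup = ℕ-Solver.solve-∀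

odd≢even : ∀ a b → suc (a + a) ≢ b + b
odd≢even zero    zero    ()
odd≢even zero    (suc b) eq = ℕ.0≢1+n (trans (ℕ.suc-injective eq) (ℕ.+-suc b b))
odd≢even (suc a) zero    ()
odd≢even (suc a) (suc b) eq =
  odd≢even a b (ℕ.suc-injective (trans (cong suc (sym (ℕ.+-suc a a))) (trans (ℕ.suc-injective eq) (ℕ.+-suc b b))))

Even-suc⇒Odd : ∀ {n} → Even (suc n) → Odd n
Even-suc⇒Odd (zero , ())
Even-suc⇒Odd (suc k , 1+n≡2k+2) = k , ℕ.suc-injective (trans 1+n≡2k+2 (ℕ.+-suc (suc k) k))

Even-+-Odd⇒Odd : ∀ m {n} → Even (m + n) → Odd n → Odd m
Even-+-Odd⇒Odd m {n} (h , m+n≡2h) (b , n≡2b+1) with even-or-odd m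
... | inj₂ m-odd = m-odd
... | inj₁ (a , m≡2a) = ⊥-elim (odd≢even (a + b) h (begin
    suc ((a + b) + (a + b))     ≡⟨ regroup a b ⟩
    (a + a) + suc (b + b)       ≡⟨ sym (cong₂ _+_ m≡2a n≡2b+1) ⟩
    m + n                       ≡⟨ m+n≡2h ⟩
    h + h                       ∎))
  where
  open ≡-Reasoning
  regroup : ∀ a b → suc ((a + b) + (a + b)) ≡ (a + a) + suc (b + b)
  regroup = ℕ-Solver.solve-∀

Odd-* : ∀ {m n} → Odd m → Odd n → Odd (m * n)
Odd-* (k , refl) (j , refl) = k + j + 2 * k * j , expand k j
  where
  expand : ∀ k j → suc (k + k) * suc (j + j) ≡ suc ((k + j + 2 * k * j) + (k + j + 2 * k * j))
  expand = ℕ-Solver.solve-∀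

Odd-^ : ∀ {m} → Odd m → ∀ n → Odd (m ^ n)
Odd-^ m-odd zero    = 0 , refl
Odd-^ m-odd (suc n) = Odd-* m-odd (Odd-^ m-odd n)

Evenℤ : ℤ → Set
Evenℤ x = ∃[ k ] x ≡ k ℤ.+ k

Evenℤ⇒Even : ∀ {n} → Evenℤ (+ n) → Even n
Evenℤ⇒Even {n} (+ k , n≡2k) = k , ℤ.+-injective (trans n≡2k (sym (ℤ.pos-+ k k)))

Evenℤ-difference : ∀ {x y} → Evenℤ x → Evenℤ y → Evenℤ (x ℤ.- y)
Evenℤ-difference (k , refl) (l , refl) = k ℤ.- l , regroup k l
  where
  regroup : ∀ k l → (k ℤ.+ k) ℤ.- (l ℤ.+ l) ≡ (k ℤ.- l) ℤ.+ (k ℤ.- l)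
  regroup = solve-∀

half-≤ : ∀ m n → m + m ≤ n + n → m ≤ n
half-≤ m n 2m≤2n = ℕ.≮⇒≥ (λ n<m → ℕ.<⇒≱ (ℕ.+-mono-< n<m n<m) 2m≤2n)

∣k∣≤∣k+k∣ : ∀ k → ∣ k ∣ ≤ ∣ k ℤ.+ k ∣
∣k∣≤∣k+k∣ (+ n)    = ℕ.m≤m+n n n
∣k∣≤∣k+k∣ -[1+ n ] = s≤s (ℕ.≤-trans (ℕ.m≤m+n n n) (ℕ.n≤1+n (n + n)))

natural-shift : ∀ W v → ∣ v ∣ ≤ W → ∃[ n ] + W ℤ.+ v ≡ + n × n ≤ W + ∣ v ∣
natural-shift W (+ m)    _      = W + m , refl , ℕ.≤-refl
natural-shift W -[1+ m ] m<W = W ∸ suc m , ℤ.⊖-≥ m<W , ℕ.≤-trans (ℕ.m∸n≤m W (suc m)) (ℕ.m≤m+n W (suc m))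

bound : List ℤ[i] → ℕ
bound []             = 0
bound ((a , b) ∷ us) = ∣ a ∣ + ∣ b ∣ + bound us

∣re∣+∣im∣≤bound : ∀ {u us} → u ∈ us → ∣ proj₁ u ∣ + ∣ proj₂ u ∣ ≤ bound us
∣re∣+∣im∣≤bound {us = (a , b) ∷ us} (here refl) = ℕ.m≤m+n (∣ a ∣ + ∣ b ∣) (bound us)
∣re∣+∣im∣≤bound {us = (a , b) ∷ us} (there u∈us) =
  ℕ.≤-trans (∣re∣+∣im∣≤bound u∈us) (ℕ.m≤n+m (bound us) (∣ a ∣ + ∣ b ∣))

sumSq : List ℕ → ℕ
sumSq ds = sum (map (λ d → d * d) ds)

sumProd : List ℕ → List ℕ → ℕ
sumProd xs ys = sum (zipWith _*_ xs ys)

sq⟨x,y⟩+ : ∀ x y P Q R →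
           sq ⟨ x , y ⟩ +ᵍ (+ P ℤ.- + Q , + (R + R)) ≡
           (+ (x * x + P) ℤ.- + (y * y + Q) , + ((x * y + R) + (x * y + R)))
sq⟨x,y⟩+ x y P Q R = cong₂ _,_
  (begin
     (+ x ℤ.* + x ℤ.- + y ℤ.* + y) ℤ.+ (+ P ℤ.- + Q)     ≡⟨ re (+ x) (+ y) (+ P) (+ Q) ⟩
     (+ x ℤ.* + x ℤ.+ + P) ℤ.- (+ y ℤ.* + y ℤ.+ + Q)     ≡⟨ sym (cong₂ ℤ._-_ (+-homo x P) (+-homo y Q)) ⟩
     + (x * x + P) ℤ.- + (y * y + Q)                      ∎)
  (begin
     (+ x ℤ.* + y ℤ.+ + y ℤ.* + x) ℤ.+ + (R + R)         ≡⟨ cong₂ ℤ._+_ (cong₂ ℤ._+_ (sym (ℤ.pos-* x y)) (sym (ℤ.pos-* y x))) refl ⟩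
     (+ (x * y) ℤ.+ + (y * x)) ℤ.+ + (R + R)              ≡⟨ sym (trans (ℤ.pos-+ (x * y + y * x) (R + R)) (cong (ℤ._+ + (R + R)) (ℤ.pos-+ (x * y) (y * x)))) ⟩
     + ((x * y + y * x) + (R + R))                        ≡⟨ cong +_ (im x y R) ⟩
     + ((x * y + R) + (x * y + R))                        ∎)
  where
  open ≡-Reasoning
  +-homo : ∀ m n → + (m * m + n) ≡ + m ℤ.* + m ℤ.+ + n
  +-homo m n = trans (ℤ.pos-+ (m * m) n) (cong (ℤ._+ + n) (ℤ.pos-* m m))
  re : ∀ x y P Q → (x ℤ.* x ℤ.- y ℤ.* y) ℤ.+ (P ℤ.- Q) ≡ (x ℤ.* x ℤ.+ P) ℤ.- (y ℤ.* y ℤ.+ Q)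
  re = solve-∀
  im : ∀ x y R → (x * y + y * x) + (R + R) ≡ (x * y + R) + (x * y + R)
  im = ℕ-Solver.solve-∀

squares-zipPad : ∀ xs ys →
                 sumᵍ (map sq (zipPad (map +_ xs) (map +_ ys))) ≡
                 (+ sumSq xs ℤ.- + sumSq ys , + (sumProd xs ys + sumProd xs ys))
squares-zipPad [] [] = refl
squares-zipPad [] (y ∷ ys) =
  trans (cong (sq ⟨ 0 , y ⟩ +ᵍ_) (squares-zipPad [] ys)) (sq⟨x,y⟩+ 0 y 0 (sumSq ys) 0)
squares-zipPad (x ∷ xs) [] = begin
    sq ⟨ x , 0 ⟩ +ᵍ sumᵍ (map sq (zipPad (map +_ xs) []))
  ≡⟨ cong (sq ⟨ x , 0 ⟩ +ᵍ_) (squares-zipPad xs []) ⟩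
    sq ⟨ x , 0 ⟩ +ᵍ (+ sumSq xs ℤ.- + 0 , + (sumProd xs [] + sumProd xs []))
  ≡⟨ cong (λ p → sq ⟨ x , 0 ⟩ +ᵍ (+ sumSq xs ℤ.- + 0 , + (p + p))) (cong sum (List.zipWith-zeroʳ _*_ xs)) ⟩
    sq ⟨ x , 0 ⟩ +ᵍ (+ sumSq xs ℤ.- + 0 , + 0)
  ≡⟨ sq⟨x,y⟩+ x 0 (sumSq xs) 0 0 ⟩
    (+ (x * x + sumSq xs) ℤ.- + 0 , + ((x * 0 + 0) + (x * 0 + 0)))
  ≡⟨ cong (λ p → (+ (x * x + sumSq xs) ℤ.- + 0 , + ((p + 0) + (p + 0)))) (ℕ.*-zeroʳ x) ⟩
    (+ (x * x + sumSq xs) ℤ.- + 0 , + 0)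
  ∎
  where open ≡-Reasoning
squares-zipPad (x ∷ xs) (y ∷ ys) =
  trans (cong (sq ⟨ x , y ⟩ +ᵍ_) (squares-zipPad xs ys)) (sq⟨x,y⟩+ x y (sumSq xs) (sumSq ys) (sumProd xs ys))

head₀ : List ℤ → ℤ
head₀ []      = + 0
head₀ (x ∷ _) = x

squares-zipPad-uncons : ∀ xs ys →
  sumᵍ (map sq (zipPad xs ys)) ≡ sq (head₀ xs , head₀ ys) +ᵍ sumᵍ (map sq (zipPad (drop 1 xs) (drop 1 ys)))
squares-zipPad-uncons [] [] = refl
squares-zipPad-uncons [] (y ∷ ys) = refl
squares-zipPad-uncons (x ∷ xs) [] = refl
squares-zipPad-uncons (x ∷ xs) (y ∷ ys) = refl

-- Base-B digits and S

module _ (B : ℕ) .{{_ : NonZero B}} (B≥2 : B ≥ 2) where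

  0<B : 0 < B
  0<B = ℕ.<-trans (s≤s z≤n) B≥2

  1<B : 1 < B
  1<B = B≥2

  private
    suc-n/B< : ∀ n f → suc n ≤ suc f → suc n / B ≤ f
    suc-n/B< n f n<f = ℕ.≤-pred (ℕ.<-≤-trans (m/n<m (suc n) B B≥2) n<f)

  digitsFuel-irrelevant : ∀ f f′ n → n ≤ f → n ≤ f′ → digitsFuel B f n ≡ digitsFuel B f′ n
  digitsFuel-irrelevant zero     zero      n       _ _ = refl
  digitsFuel-irrelevant zero     (suc f′)  zero    _ _ = refl
  digitsFuel-irrelevant (suc f)  zero      zero    _ _ = refl
  digitsFuel-irrelevant (suc f)  (suc f′)  zero    _ _ = refl
  digitsFuel-irrelevant (suc f)  (suc f′)  (suc n) n≤f n≤f′ =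
    cong (suc n % B ∷_) (digitsFuel-irrelevant f f′ (suc n / B) (suc-n/B< n f n≤f) (suc-n/B< n f′ n≤f′))

  digits-suc : ∀ n → digits B (suc n) ≡ suc n % B ∷ digits B (suc n / B)
  digits-suc n = cong (suc n % B ∷_)
    (digitsFuel-irrelevant n (suc n / B) (suc n / B) (suc-n/B< n n ℕ.≤-refl) ℕ.≤-refl)

  signedDigits-+ : ∀ a → signedDigits B (+ a) ≡ map +_ (digits B a)
  signedDigits-+ a = List.map-cong (λ { zero → refl ; (suc d) → refl }) (digits B a)

  S⟨⟩-digits : ∀ a b → S B ⟨ a , b ⟩ ≡ sumᵍ (map sq (zipPad (map +_ (digits B a)) (map +_ (digits B b))))
  S⟨⟩-digits a b = cong₂ (λ u v → sumᵍ (map sq (zipPad u v))) (signedDigits-+ a) (signedDigits-+ b)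

  head₀-digits : ∀ a → head₀ (map +_ (digits B a)) ≡ + (a % B)
  head₀-digits zero    = cong +_ (sym (m<n⇒m%n≡m 0<B))
  head₀-digits (suc a) = cong (λ ds → head₀ (map +_ ds)) (digits-suc a)

  drop1-digits : ∀ a → drop 1 (map +_ (digits B a)) ≡ map +_ (digits B (a / B))
  drop1-digits zero    = cong (λ n → map +_ (digits B n)) (sym (0/n≡0 B))
  drop1-digits (suc a) = cong (λ ds → drop 1 (map +_ ds)) (digits-suc a)

  S-step : ∀ a b → S B ⟨ a , b ⟩ ≡ sq ⟨ a % B , b % B ⟩ +ᵍ S B ⟨ a / B , b / B ⟩
  S-step a b = begin
      S B ⟨ a , b ⟩
    ≡⟨ S⟨⟩-digits a b ⟩
      sumᵍ (map sq (zipPad (map +_ (digits B a)) (map +_ (digits B b))))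
    ≡⟨ squares-zipPad-uncons (map +_ (digits B a)) (map +_ (digits B b)) ⟩
      sq (head₀ (map +_ (digits B a)) , head₀ (map +_ (digits B b)))
        +ᵍ sumᵍ (map sq (zipPad (drop 1 (map +_ (digits B a))) (drop 1 (map +_ (digits B b)))))
    ≡⟨ cong₂ (λ u v → sq u +ᵍ v) (cong₂ _,_ (head₀-digits a) (head₀-digits b))
         (trans (cong₂ (λ u v → sumᵍ (map sq (zipPad u v))) (drop1-digits a) (drop1-digits b))
                (sym (S⟨⟩-digits (a / B) (b / B)))) ⟩
      sq ⟨ a % B , b % B ⟩ +ᵍ S B ⟨ a / B , b / B ⟩
    ∎
    where open ≡-Reasoning

  [r+q*B]%B≡r : ∀ r q → r < B → (r + q * B) % B ≡ r
  [r+q*B]%B≡r r q r<B = trans ([m+kn]%n≡m%n r q B) (m<n⇒m%n≡m r<B)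

  [r+q*B]/B≡q : ∀ r q → r < B → (r + q * B) / B ≡ q
  [r+q*B]/B≡q r q r<B = begin
      (r + q * B) / B        ≡⟨ +-distrib-/-∣ʳ r (divides-refl q) ⟩
      r / B + q * B / B      ≡⟨ cong₂ _+_ (m<n⇒m/n≡0 r<B) (m*n/n≡m q B) ⟩
      q                      ∎
    where open ≡-Reasoning

  S-digit-step : ∀ r s a b → r < B → s < B → S B ⟨ r + a * B , s + b * B ⟩ ≡ sq ⟨ r , s ⟩ +ᵍ S B ⟨ a , b ⟩
  S-digit-step r s a b r<B s<B = trans (S-step (r + a * B) (s + b * B))
    (cong₂ (λ u v → sq u +ᵍ S B v)
      (cong₂ ⟨_,_⟩ ([r+q*B]%B≡r r a r<B) ([r+q*B]%B≡r s b s<B))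
      (cong₂ ⟨_,_⟩ ([r+q*B]/B≡q r a r<B) ([r+q*B]/B≡q s b s<B)))

  S-digit : ∀ r s → r < B → s < B → S B ⟨ r , s ⟩ ≡ sq ⟨ r , s ⟩
  S-digit r s r<B s<B = begin
      S B ⟨ r , s ⟩                          ≡⟨ cong₂ (λ u v → S B ⟨ u , v ⟩) (sym (ℕ.+-identityʳ r)) (sym (ℕ.+-identityʳ s)) ⟩
      S B ⟨ r + 0 * B , s + 0 * B ⟩          ≡⟨ S-digit-step r s 0 0 r<B s<B ⟩
      sq ⟨ r , s ⟩ +ᵍ 0ᵍ                     ≡⟨ +ᵍ-identityʳ (sq ⟨ r , s ⟩) ⟩
      sq ⟨ r , s ⟩                           ∎
    where open ≡-Reasoning

  B^n>0 : ∀ n → 0 < B ^ n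
  B^n>0 = ℕ.m^n>0 B

  n<B^n : ∀ n → n < B ^ n
  n<B^n zero = s≤s z≤n
  n<B^n (suc n) = begin-strict
      suc n              <⟨ s≤s (n<B^n n) ⟩
      1 + B ^ n          ≤⟨ ℕ.+-monoˡ-≤ (B ^ n) (B^n>0 n) ⟩
      B ^ n + B ^ n      ≡⟨ cong (λ t → B ^ n + t) (sym (ℕ.+-identityʳ (B ^ n))) ⟩
      2 * B ^ n          ≤⟨ ℕ.*-monoˡ-≤ (B ^ n) B≥2 ⟩
      B * B ^ n          ∎
    where open ℕ.≤-Reasoning

  S-concat : ∀ L a b x y → x < B ^ L → y < B ^ L →
             S B ⟨ x + B ^ L * a , y + B ^ L * b ⟩ ≡ S B ⟨ a , b ⟩ +ᵍ S B ⟨ x , y ⟩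
  S-concat zero a b zero zero (s≤s z≤n) (s≤s z≤n) =
    trans (cong₂ (λ u v → S B ⟨ u , v ⟩) (ℕ.*-identityˡ a) (ℕ.*-identityˡ b)) (sym (+ᵍ-identityʳ _))
  S-concat (suc L) a b x y x<B^L+1 y<B^L+1 = begin
      S B ⟨ x + B ^ suc L * a , y + B ^ suc L * b ⟩
    ≡⟨ cong₂ (λ u v → S B ⟨ u , v ⟩) (split x a) (split y b) ⟩
      S B ⟨ x % B + (x / B + B ^ L * a) * B , y % B + (y / B + B ^ L * b) * B ⟩
    ≡⟨ S-digit-step (x % B) (y % B) (x / B + B ^ L * a) (y / B + B ^ L * b) (m%n<n x B) (m%n<n y B) ⟩
      sq ⟨ x % B , y % B ⟩ +ᵍ S B ⟨ x / B + B ^ L * a , y / B + B ^ L * b ⟩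
    ≡⟨ cong (sq ⟨ x % B , y % B ⟩ +ᵍ_) (S-concat L a b (x / B) (y / B) (shrink x<B^L+1) (shrink y<B^L+1)) ⟩
      sq ⟨ x % B , y % B ⟩ +ᵍ (S B ⟨ a , b ⟩ +ᵍ S B ⟨ x / B , y / B ⟩)
    ≡⟨ +ᵍ-left-comm (sq ⟨ x % B , y % B ⟩) (S B ⟨ a , b ⟩) (S B ⟨ x / B , y / B ⟩) ⟩
      S B ⟨ a , b ⟩ +ᵍ (sq ⟨ x % B , y % B ⟩ +ᵍ S B ⟨ x / B , y / B ⟩)
    ≡⟨ cong (S B ⟨ a , b ⟩ +ᵍ_) (sym (S-step x y)) ⟩
      S B ⟨ a , b ⟩ +ᵍ S B ⟨ x , y ⟩
    ∎
    where
    open ≡-Reasoning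
    split : ∀ x a → x + B ^ suc L * a ≡ x % B + (x / B + B ^ L * a) * B
    split x a = trans (cong (_+ B ^ suc L * a) (m≡m%n+[m/n]*n x B)) (regroup (x % B) (x / B) B (B ^ L) a)
      where
      regroup : ∀ r q B P a → r + q * B + B * P * a ≡ r + (q + P * a) * B
      regroup = ℕ-Solver.solve-∀
    shrink : ∀ {x} → x < B ^ suc L → x / B < B ^ L
    shrink {x} x<B^L+1 = m<n*o⇒m/o<n (subst (x <_) (ℕ.*-comm B (B ^ L)) x<B^L+1)

  S-shift : ∀ L a b → S B ⟨ B ^ L * a , B ^ L * b ⟩ ≡ S B ⟨ a , b ⟩
  S-shift L a b = trans (S-concat L a b 0 0 (B^n>0 L) (B^n>0 L)) (+ᵍ-identityʳ _)

  Σsq : ℕ → ℕ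
  Σsq n = sumSq (digits B n)

  S-re-im : ∀ a b → S B ⟨ a , b ⟩ ≡
            (+ Σsq a ℤ.- + Σsq b , + (sumProd (digits B a) (digits B b) + sumProd (digits B a) (digits B b)))
  S-re-im a b = trans (S⟨⟩-digits a b) (squares-zipPad (digits B a) (digits B b))

  S-im-even : ∀ a b → Evenℤ (proj₂ (S B ⟨ a , b ⟩))
  S-im-even a b = + p , trans (cong proj₂ (S-re-im a b)) (ℤ.pos-+ p p)
    where p = sumProd (digits B a) (digits B b)

  S-real : ∀ n → S B ⟨ n , 0 ⟩ ≡ (+ Σsq n , + 0)
  S-real n = trans (S-re-im n 0) (cong₂ _,_ (ℤ.+-identityʳ (+ Σsq n))
                                            (cong (λ p → + (sum p + sum p)) (List.zipWith-zeroʳ _*_ (digits B n))))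

  S-imag : ∀ n → S B ⟨ 0 , n ⟩ ≡ (ℤ.- + Σsq n , + 0)
  S-imag n = trans (S-re-im 0 n) (cong₂ _,_ (ℤ.+-identityˡ (ℤ.- + Σsq n)) refl)

  Σsq-step : ∀ n → Σsq n ≡ (n % B) * (n % B) + Σsq (n / B)
  Σsq-step zero = cong₂ (λ r q → r * r + Σsq q) (sym (m<n⇒m%n≡m 0<B)) (sym (0/n≡0 B))
  Σsq-step (suc n) = cong sumSq (digits-suc n)

  Σsq-digit : ∀ c → c < B → Σsq c ≡ c * c
  Σsq-digit c c<B = begin
      Σsq c                             ≡⟨ Σsq-step c ⟩
      (c % B) * (c % B) + Σsq (c / B)   ≡⟨ cong₂ (λ r q → r * r + Σsq q) (m<n⇒m%n≡m c<B) (m<n⇒m/n≡0 c<B) ⟩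
      c * c + 0                         ≡⟨ ℕ.+-identityʳ (c * c) ⟩
      c * c                             ∎
    where open ≡-Reasoning

  Σsq-concat : ∀ L a x → x < B ^ L → Σsq (x + B ^ L * a) ≡ Σsq a + Σsq x
  Σsq-concat L a x x<B^L = ℤ.+-injective (cong proj₁ (begin
      (+ Σsq (x + B ^ L * a) , + 0)                 ≡⟨ sym (S-real (x + B ^ L * a)) ⟩
      S B ⟨ x + B ^ L * a , 0 ⟩                     ≡⟨ cong (λ t → S B ⟨ x + B ^ L * a , t ⟩) (sym (ℕ.*-zeroʳ (B ^ L))) ⟩
      S B ⟨ x + B ^ L * a , 0 + B ^ L * 0 ⟩         ≡⟨ S-concat L a 0 x 0 x<B^L (B^n>0 L) ⟩
      S B ⟨ a , 0 ⟩ +ᵍ S B ⟨ x , 0 ⟩                ≡⟨ cong₂ _+ᵍ_ (S-real a) (S-real x) ⟩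
      (+ Σsq a ℤ.+ + Σsq x , + 0)                   ≡⟨ cong (_, + 0) (sym (ℤ.pos-+ (Σsq a) (Σsq x))) ⟩
      (+ (Σsq a + Σsq x) , + 0)                     ∎))
    where open ≡-Reasoning

  Σsq+n-even : Odd B → ∀ n → Even (Σsq n + n)
  Σsq+n-even (k , B≡2k+1) = <-rec (λ n → Even (Σsq n + n)) step
    where
    step : ∀ n → (∀ {m} → m < n → Even (Σsq m + m)) → Even (Σsq n + n)
    step zero    _  = 0 , refl
    step (suc m) ih with n*n+n-even (suc m % B) | ih (m/n<m (suc m) B B≥2)
    ... | h , d²+d≡2h | j , Σq+q≡2j = h + j + k * q , (begin
        Σsq n + n                                        ≡⟨ cong₂ _+_ (Σsq-step n) (m≡m%n+[m/n]*n n B) ⟩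
        (d * d + Σsq q) + (d + q * B)                    ≡⟨ cong (λ b → (d * d + Σsq q) + (d + q * b)) B≡2k+1 ⟩
        (d * d + Σsq q) + (d + q * suc (k + k))          ≡⟨ regroup (d * d) d (Σsq q) q k ⟩
        (d * d + d) + (Σsq q + q) + (k * q + k * q)      ≡⟨ cong₂ (λ u v → u + v + (k * q + k * q)) d²+d≡2h Σq+q≡2j ⟩
        (h + h) + (j + j) + (k * q + k * q)              ≡⟨ halve h j (k * q) ⟩
        (h + j + k * q) + (h + j + k * q)                ∎)
      where
      open ≡-Reasoning
      n = suc m
      d = n % B
      q = n / B
      regroup : ∀ d² d s q k → (d² + s) + (d + q * suc (k + k)) ≡ (d² + d) + (s + q) + (k * q + k * q)
      regroup = ℕ-Solver.solve-∀
      halve : ∀ h j t → (h + h) + (j + j) + (t + t) ≡ (h + j + t) + (h + j + t)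
      halve = ℕ-Solver.solve-∀

  B-1 : ℕ
  B-1 = ℕ.pred B

  B≡1+B-1 : B ≡ suc B-1
  B≡1+B-1 = sym (ℕ.suc-pred B)

  private
    multiple-of-B-below-2B : ∀ x → x % B ≡ 0 → 0 < x → x < 2 * B → x ≡ B
    multiple-of-B-below-2B x x%B≡0 0<x x<2B with x / B in x/B≡ | m<n*o⇒m/o<n {x} {2} {B} x<2B
    ... | zero | _ = ⊥-elim (ℕ.<-irrefl (sym x≡0) 0<x)
      where
      x≡0 : x ≡ 0
      x≡0 = trans (m≡m%n+[m/n]*n x B) (cong₂ (λ r q → r + q * B) x%B≡0 x/B≡)
    ... | suc zero | _ = trans (m≡m%n+[m/n]*n x B) (trans (cong₂ (λ r q → r + q * B) x%B≡0 x/B≡) (ℕ.+-identityʳ B))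
    ... | suc (suc _) | s≤s (s≤s ())

  complementary-digits : ∀ L w c → w + c + 1 ≡ B ^ suc L →
                         (w % B + c % B + 1 ≡ B) × (w / B + c / B + 1 ≡ B ^ L)
  complementary-digits L w c w+c+1≡B^L+1 = low≡B , ℕ.*-cancelʳ-≡ (high + 1) (B ^ L) B high-eq
    where
    low = w % B + c % B + 1
    high = w / B + c / B
    low+high*B : low + high * B ≡ B ^ L * B
    low+high*B = begin
        low + high * B                                       ≡⟨ regroup (w % B) (c % B) (w / B) (c / B) B ⟩
        (w % B + w / B * B) + (c % B + c / B * B) + 1        ≡⟨ cong₂ (λ u v → u + v + 1) (sym (m≡m%n+[m/n]*n w B)) (sym (m≡m%n+[m/n]*n c B)) ⟩
        w + c + 1                                            ≡⟨ w+c+1≡B^L+1 ⟩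
        B * B ^ L                                            ≡⟨ ℕ.*-comm B (B ^ L) ⟩
        B ^ L * B                                            ∎
      where
      open ≡-Reasoning
      regroup : ∀ a b p q B → a + b + 1 + (p + q) * B ≡ (a + p * B) + (b + q * B) + 1
      regroup = ℕ-Solver.solve-∀
    low<2B : low < 2 * B
    low<2B = begin-strict
        w % B + c % B + 1        ≡⟨ ℕ.+-comm (w % B + c % B) 1 ⟩
        suc (w % B) + c % B      ≤⟨ ℕ.+-monoˡ-≤ (c % B) (m%n<n w B) ⟩
        B + c % B                <⟨ ℕ.+-monoʳ-< B (m%n<n c B) ⟩
        B + B                    ≡⟨ cong (λ t → B + t) (sym (ℕ.+-identityʳ B)) ⟩
        2 * B                    ∎
      where open ℕ.≤-Reasoning
    low≡B : low ≡ B
    low≡B = multiple-of-B-below-2B low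
      (trans (sym ([m+kn]%n≡m%n low high B)) (trans (cong (_% B) low+high*B) (m*n%n≡0 (B ^ L) B)))
      (subst (0 <_) (ℕ.+-comm 1 (w % B + c % B)) (s≤s z≤n))
      low<2B
    high-eq : (high + 1) * B ≡ B ^ L * B
    high-eq = begin
        (high + 1) * B       ≡⟨ regroup high B ⟩
        B + high * B         ≡⟨ cong (_+ high * B) (sym low≡B) ⟩
        low + high * B       ≡⟨ low+high*B ⟩
        B ^ L * B            ∎
      where
      open ≡-Reasoning
      regroup : ∀ y b → (y + 1) * b ≡ b + y * b
      regroup = ℕ-Solver.solve-∀

  -- Complementary digits w_j + c_j = B - 1 give c_j² - w_j² = (c_j - w_j) (B - 1).
  Σsq-complement : ∀ L w c → w + c + 1 ≡ B ^ L → ∃[ k ] + Σsq c ℤ.- + Σsq w ≡ k ℤ.* + B-1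
  Σsq-complement zero w c w+c+1≡1
    with ℕ.m+n≡0⇒m≡0 w (ℕ.+-cancelʳ-≡ 1 (w + c) 0 w+c+1≡1) | ℕ.m+n≡0⇒n≡0 w (ℕ.+-cancelʳ-≡ 1 (w + c) 0 w+c+1≡1)
  ... | refl | refl = + 0 , refl
  Σsq-complement (suc L) w c w+c+1≡B^L+1 with complementary-digits L w c w+c+1≡B^L+1
  ... | low≡B , high+1≡B^L with Σsq-complement L (w / B) (c / B) high+1≡B^L
  ... | k , ih = (+ dc ℤ.- + dw) ℤ.+ k , (begin
      + Σsq c ℤ.- + Σsq w
    ≡⟨ cong₂ (λ u v → + u ℤ.- + v) (Σsq-step c) (Σsq-step w) ⟩
      + (dc * dc + Σsq (c / B)) ℤ.- + (dw * dw + Σsq (w / B))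
    ≡⟨ cong₂ ℤ._-_ (cast dc (Σsq (c / B))) (cast dw (Σsq (w / B))) ⟩
      (+ dc ℤ.* + dc ℤ.+ + Σsq (c / B)) ℤ.- (+ dw ℤ.* + dw ℤ.+ + Σsq (w / B))
    ≡⟨ factor (+ dc) (+ dw) (+ Σsq (c / B)) (+ Σsq (w / B)) ⟩
      (+ dc ℤ.- + dw) ℤ.* (+ dc ℤ.+ + dw) ℤ.+ (+ Σsq (c / B) ℤ.- + Σsq (w / B))
    ≡⟨ cong₂ (λ u v → (+ dc ℤ.- + dw) ℤ.* u ℤ.+ v) dc+dw≡B-1 ih ⟩
      (+ dc ℤ.- + dw) ℤ.* + B-1 ℤ.+ k ℤ.* + B-1
    ≡⟨ sym (ℤ.*-distribʳ-+ (+ B-1) (+ dc ℤ.- + dw) k) ⟩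
      ((+ dc ℤ.- + dw) ℤ.+ k) ℤ.* + B-1
    ∎)
    where
    open ≡-Reasoning
    dc = c % B
    dw = w % B
    cast : ∀ d s → + (d * d + s) ≡ + d ℤ.* + d ℤ.+ + s
    cast d s = trans (ℤ.pos-+ (d * d) s) (cong (ℤ._+ + s) (ℤ.pos-* d d))
    factor : ∀ a b s t → (a ℤ.* a ℤ.+ s) ℤ.- (b ℤ.* b ℤ.+ t) ≡ (a ℤ.- b) ℤ.* (a ℤ.+ b) ℤ.+ (s ℤ.- t)
    factor = solve-∀
    dc+dw≡B-1 : + dc ℤ.+ + dw ≡ + B-1
    dc+dw≡B-1 = trans (sym (ℤ.pos-+ dc dw)) (cong +_ (ℕ.suc-injective (begin
        suc (dc + dw)          ≡⟨ ℕ.+-comm 1 (dc + dw) ⟩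
        dc + dw + 1            ≡⟨ cong (_+ 1) (ℕ.+-comm dc dw) ⟩
        dw + dc + 1            ≡⟨ low≡B ⟩
        B                      ≡⟨ B≡1+B-1 ⟩
        suc B-1                ∎)))

  instance
    B-1≢0 : NonZero B-1
    B-1≢0 = ℕ.>-nonZero (ℕ.≤-pred (subst (2 ≤_) B≡1+B-1 B≥2))

  make-odd-with-B-1 : ∀ t → Even B ⊎ Odd t → ∃[ j ] ∃[ h ] t + j * B-1 ≡ suc (h + h)
  make-odd-with-B-1 t (inj₂ (h , t≡2h+1)) = 0 , h , trans (ℕ.+-identityʳ t) t≡2h+1
  make-odd-with-B-1 t (inj₁ B-even) with even-or-odd t | Even-suc⇒Odd (subst Even B≡1+B-1 B-even)
  ... | inj₂ (h , t≡2h+1) | _ = 0 , h , trans (ℕ.+-identityʳ t) t≡2h+1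
  ... | inj₁ (h , t≡2h) | k , B-1≡2k+1 = 1 , h + k , (begin
      t + 1 * B-1              ≡⟨ cong₂ _+_ t≡2h (ℕ.*-identityˡ B-1) ⟩
      h + h + B-1              ≡⟨ cong (λ b → h + h + b) B-1≡2k+1 ⟩
      h + h + suc (k + k)      ≡⟨ regroup h k ⟩
      suc ((h + k) + (h + k))  ∎)
    where
    open ≡-Reasoning
    regroup : ∀ h k → h + h + suc (k + k) ≡ suc ((h + k) + (h + k))
    regroup = ℕ-Solver.solve-∀

  -- 2 is invertible modulo B - 1 when B is even; otherwise t must be odd.
  odd-residue : ∀ t → Even B ⊎ Odd t → ∃[ c ] suc c < B × ∃[ k ] + suc (c + c) ℤ.- + t ≡ k ℤ.* + B-1
  odd-residue t t-odd-or-B-even with make-odd-with-B-1 t t-odd-or-B-even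
  ... | j , h , t+j[B-1]≡2h+1 =
    c , subst (suc c <_) (sym B≡1+B-1) (s≤s (m%n<n h B-1)) , + j ℤ.- (+ q ℤ.+ + q) , (begin
      + suc (c + c) ℤ.- + t
    ≡⟨ regroup (+ c) (+ t) (+ j) (+ q) (+ B-1) ⟩
      ((+ 1 ℤ.+ ((+ c ℤ.+ + q ℤ.* + B-1) ℤ.+ (+ c ℤ.+ + q ℤ.* + B-1))) ℤ.- (+ t ℤ.+ + j ℤ.* + B-1))
        ℤ.+ (+ j ℤ.- (+ q ℤ.+ + q)) ℤ.* + B-1
    ≡⟨ cong (λ z → (+ 1 ℤ.+ (z ℤ.+ z) ℤ.- (+ t ℤ.+ + j ℤ.* + B-1)) ℤ.+ (+ j ℤ.- (+ q ℤ.+ + q)) ℤ.* + B-1) (sym h≡c+q[B-1]) ⟩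
      ((+ 1 ℤ.+ (+ h ℤ.+ + h)) ℤ.- (+ t ℤ.+ + j ℤ.* + B-1)) ℤ.+ (+ j ℤ.- (+ q ℤ.+ + q)) ℤ.* + B-1
    ≡⟨ cong (λ z → (+ 1 ℤ.+ (+ h ℤ.+ + h) ℤ.- z) ℤ.+ (+ j ℤ.- (+ q ℤ.+ + q)) ℤ.* + B-1) t+j[B-1]≡2h+1ℤ ⟩
      ((+ 1 ℤ.+ (+ h ℤ.+ + h)) ℤ.- (+ 1 ℤ.+ (+ h ℤ.+ + h))) ℤ.+ (+ j ℤ.- (+ q ℤ.+ + q)) ℤ.* + B-1
    ≡⟨ cong (ℤ._+ (+ j ℤ.- (+ q ℤ.+ + q)) ℤ.* + B-1) (ℤ.+-inverseʳ (+ 1 ℤ.+ (+ h ℤ.+ + h))) ⟩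
      + 0 ℤ.+ (+ j ℤ.- (+ q ℤ.+ + q)) ℤ.* + B-1
    ≡⟨ ℤ.+-identityˡ _ ⟩
      (+ j ℤ.- (+ q ℤ.+ + q)) ℤ.* + B-1
    ∎)
    where
    open ≡-Reasoning
    c = h % B-1
    q = h / B-1
    h≡c+q[B-1] : + h ≡ + c ℤ.+ + q ℤ.* + B-1
    h≡c+q[B-1] = trans (cong +_ (m≡m%n+[m/n]*n h B-1)) (trans (ℤ.pos-+ c (q * B-1)) (cong (λ z → + c ℤ.+ z) (ℤ.pos-* q B-1)))
    t+j[B-1]≡2h+1ℤ : + t ℤ.+ + j ℤ.* + B-1 ≡ + 1 ℤ.+ (+ h ℤ.+ + h)
    t+j[B-1]≡2h+1ℤ = trans (cong (λ z → + t ℤ.+ z) (sym (ℤ.pos-* j B-1))) (cong +_ t+j[B-1]≡2h+1)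
    regroup : ∀ c t j q e → (+ 1 ℤ.+ (c ℤ.+ c)) ℤ.- t ≡
              ((+ 1 ℤ.+ ((c ℤ.+ q ℤ.* e) ℤ.+ (c ℤ.+ q ℤ.* e))) ℤ.- (t ℤ.+ j ℤ.* e)) ℤ.+ (j ℤ.- (q ℤ.+ q)) ℤ.* e
    regroup = solve-∀

  -- With R = r + 1 and P = B^R, the low digits of P - R complement those of r.
  Σsq-gap : ∀ r c → suc c < B →
            ∃[ k ] + Σsq (B ^ suc r * suc c) ℤ.- + Σsq ((B ^ suc r ∸ suc r) + B ^ suc r * c) ≡
                   (+ suc (c + c) ℤ.- + Σsq r) ℤ.- k ℤ.* + B-1
  Σsq-gap r c suc-c<B = proj₁ complement , (begin
      + Σsq (P * suc c) ℤ.- + Σsq ((P ∸ R) + P * c)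
    ≡⟨ cong₂ (λ a b → + a ℤ.- + b) Σsq-high Σsq-low ⟩
      + (suc c * suc c) ℤ.- + (c * c + Σsq (P ∸ R))
    ≡⟨ cong₂ ℤ._-_ (ℤ.pos-* (suc c) (suc c)) (trans (ℤ.pos-+ (c * c) (Σsq (P ∸ R))) (cong (ℤ._+ + Σsq (P ∸ R)) (ℤ.pos-* c c))) ⟩
      (+ 1 ℤ.+ + c) ℤ.* (+ 1 ℤ.+ + c) ℤ.- (+ c ℤ.* + c ℤ.+ + Σsq (P ∸ R))
    ≡⟨ regroup (+ c) (+ Σsq (P ∸ R)) (+ Σsq r) ⟩
      (+ suc (c + c) ℤ.- + Σsq r) ℤ.- (+ Σsq (P ∸ R) ℤ.- + Σsq r)
    ≡⟨ cong (λ d → (+ suc (c + c) ℤ.- + Σsq r) ℤ.- d) (proj₂ complement) ⟩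
      (+ suc (c + c) ℤ.- + Σsq r) ℤ.- proj₁ complement ℤ.* + B-1
    ∎)
    where
    open ≡-Reasoning
    R = suc r
    P = B ^ R
    R≤P : R ≤ P
    R≤P = ℕ.<⇒≤ (n<B^n R)
    complement : ∃[ k ] + Σsq (P ∸ R) ℤ.- + Σsq r ≡ k ℤ.* + B-1
    complement = Σsq-complement R r (P ∸ R) (trans (rearrange r (P ∸ R)) (ℕ.m∸n+n≡m R≤P))
      where
      rearrange : ∀ r x → r + x + 1 ≡ x + suc r
      rearrange = ℕ-Solver.solve-∀
    Σsq-high : Σsq (P * suc c) ≡ suc c * suc c
    Σsq-high = begin
        Σsq (0 + P * suc c)            ≡⟨ Σsq-concat R (suc c) 0 (B^n>0 R) ⟩
        Σsq (suc c) + 0                ≡⟨ ℕ.+-identityʳ (Σsq (suc c)) ⟩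
        Σsq (suc c)                    ≡⟨ Σsq-digit (suc c) suc-c<B ⟩
        suc c * suc c                  ∎
    Σsq-low : Σsq ((P ∸ R) + P * c) ≡ c * c + Σsq (P ∸ R)
    Σsq-low = trans (Σsq-concat R c (P ∸ R) (subst (P ∸ R <_) (ℕ.m∸n+n≡m R≤P) (ℕ.m<m+n (P ∸ R) (s≤s z≤n))))
                    (cong (_+ Σsq (P ∸ R)) (Σsq-digit c (ℕ.<-trans (ℕ.n<1+n c) suc-c<B)))
    regroup : ∀ c s t → (+ 1 ℤ.+ c) ℤ.* (+ 1 ℤ.+ c) ℤ.- (c ℤ.* c ℤ.+ s) ≡ ((+ 1 ℤ.+ (c ℤ.+ c)) ℤ.- t) ℤ.- (s ℤ.- t)
    regroup = solve-∀

  -- Values of S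

  fromDigits : List (ℕ × ℕ) → ℕ × ℕ
  fromDigits []             = (0 , 0)
  fromDigits ((x , y) ∷ ds) = (x + proj₁ (fromDigits ds) * B , y + proj₂ (fromDigits ds) * B)

  IsDigit : ℕ × ℕ → Set
  IsDigit (x , y) = x < B × y < B

  squaresᵍ : List (ℕ × ℕ) → ℤ[i]
  squaresᵍ ds = sumᵍ (map (λ d → sq (uncurry ⟨_,_⟩ d)) ds)

  S-fromDigits : ∀ ds → All IsDigit ds → S B (uncurry ⟨_,_⟩ (fromDigits ds)) ≡ squaresᵍ ds
  S-fromDigits []             []                = refl
  S-fromDigits ((x , y) ∷ ds) ((x<B , y<B) ∷ dsᵈ) =
    trans (S-digit-step x y (proj₁ (fromDigits ds)) (proj₂ (fromDigits ds)) x<B y<B) (cong (sq ⟨ x , y ⟩ +ᵍ_) (S-fromDigits ds dsᵈ))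

  squaresᵍ-++ : ∀ ds es → squaresᵍ (ds ++ es) ≡ squaresᵍ ds +ᵍ squaresᵍ es
  squaresᵍ-++ []       es = sym (+ᵍ-identityˡ _)
  squaresᵍ-++ (d ∷ ds) es =
    trans (cong (sq (uncurry ⟨_,_⟩ d) +ᵍ_) (squaresᵍ-++ ds es)) (sym (+ᵍ-assoc (sq (uncurry ⟨_,_⟩ d)) (squaresᵍ ds) (squaresᵍ es)))

  squaresᵍ-replicate-1+i : ∀ n → squaresᵍ (replicate n (1 , 1)) ≡ (+ 0 , + (n + n))
  squaresᵍ-replicate-1+i zero = refl
  squaresᵍ-replicate-1+i (suc n) =
    trans (cong (sq ⟨ 1 , 1 ⟩ +ᵍ_) (squaresᵍ-replicate-1+i n)) (cong (λ t → (+ 0 , + suc t)) (sym (ℕ.+-suc n n)))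

  squaresᵍ-replicate-1 : ∀ n → squaresᵍ (replicate n (1 , 0)) ≡ (+ n , + 0)
  squaresᵍ-replicate-1 zero = refl
  squaresᵍ-replicate-1 (suc n) = cong (sq ⟨ 1 , 0 ⟩ +ᵍ_) (squaresᵍ-replicate-1 n)

  squaresᵍ-replicate-i : ∀ n → squaresᵍ (replicate (suc n) (0 , 1)) ≡ (-[1+ n ] , + 0)
  squaresᵍ-replicate-i zero = refl
  squaresᵍ-replicate-i (suc n) = cong (sq ⟨ 0 , 1 ⟩ +ᵍ_) (squaresᵍ-replicate-i n)

  realDigits : ℤ → List (ℕ × ℕ)
  realDigits (+ n)    = replicate n (1 , 0)
  realDigits -[1+ n ] = replicate (suc n) (0 , 1)

  squaresᵍ-realDigits : ∀ X → squaresᵍ (realDigits X) ≡ (X , + 0)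
  squaresᵍ-realDigits (+ n)    = squaresᵍ-replicate-1 n
  squaresᵍ-realDigits -[1+ n ] = squaresᵍ-replicate-i n

  realDigits-digits : ∀ X → All IsDigit (realDigits X)
  realDigits-digits (+ n)    = All.replicate⁺ n (1<B , 0<B)
  realDigits-digits -[1+ n ] = All.replicate⁺ (suc n) (0<B , 1<B)

  private
    representing-digits : ℤ → ℕ → List (ℕ × ℕ)
    representing-digits X Y = replicate Y (1 , 1) ++ realDigits X

    representing-digits-valid : ∀ X Y → All IsDigit (representing-digits X Y)
    representing-digits-valid X Y = All.++⁺ (All.replicate⁺ Y (1<B , 1<B)) (realDigits-digits X)

    S-representing-digits : ∀ X Y →
      S B (uncurry ⟨_,_⟩ (fromDigits (representing-digits X Y))) ≡ (X , + (Y + Y))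
    S-representing-digits X Y = begin
        S B (uncurry ⟨_,_⟩ (fromDigits (representing-digits X Y)))
      ≡⟨ S-fromDigits (representing-digits X Y) (representing-digits-valid X Y) ⟩
        squaresᵍ (replicate Y (1 , 1) ++ realDigits X)
      ≡⟨ squaresᵍ-++ (replicate Y (1 , 1)) (realDigits X) ⟩
        squaresᵍ (replicate Y (1 , 1)) +ᵍ squaresᵍ (realDigits X)
      ≡⟨ cong₂ _+ᵍ_ (squaresᵍ-replicate-1+i Y) (squaresᵍ-realDigits X) ⟩
        (+ 0 ℤ.+ X , + (Y + Y) ℤ.+ + 0)
      ≡⟨ cong₂ _,_ (ℤ.+-identityˡ X) (ℤ.+-identityʳ (+ (Y + Y))) ⟩
        (X , + (Y + Y))
      ∎
      where open ≡-Reasoning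

  -- The extra digits 1 and i contribute 1 - 1 = 0 to S and make an odd imaginary part even.
  representable : ∀ X Y → ∃[ a ] ∃[ b ] Even b × S B ⟨ a , b ⟩ ≡ (X , + (Y + Y))
  representable X Y with even-or-odd (proj₂ (fromDigits (representing-digits X Y)))
  ... | inj₁ b-even = _ , _ , b-even , S-representing-digits X Y
  ... | inj₂ (h , b≡2h+1) = _ , _ , b′-even , (begin
      S B (uncurry ⟨_,_⟩ (fromDigits ((1 , 0) ∷ (0 , 1) ∷ ds)))
    ≡⟨ S-fromDigits ((1 , 0) ∷ (0 , 1) ∷ ds) ((1<B , 0<B) ∷ (0<B , 1<B) ∷ representing-digits-valid X Y) ⟩
      sq ⟨ 1 , 0 ⟩ +ᵍ (sq ⟨ 0 , 1 ⟩ +ᵍ squaresᵍ ds)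
    ≡⟨ sym (+ᵍ-assoc (sq ⟨ 1 , 0 ⟩) (sq ⟨ 0 , 1 ⟩) (squaresᵍ ds)) ⟩
      0ᵍ +ᵍ squaresᵍ ds
    ≡⟨ +ᵍ-identityˡ (squaresᵍ ds) ⟩
      squaresᵍ ds
    ≡⟨ sym (S-fromDigits ds (representing-digits-valid X Y)) ⟩
      S B (uncurry ⟨_,_⟩ (fromDigits ds))
    ≡⟨ S-representing-digits X Y ⟩
      (X , + (Y + Y))
    ∎)
    where
    open ≡-Reasoning
    ds = representing-digits X Y
    b′-even : Even (0 + (1 + proj₂ (fromDigits ds) * B) * B)
    b′-even with n*n+n-even B
    ... | g , B²+B≡2g = g + h * B * B , (begin
        0 + (1 + proj₂ (fromDigits ds) * B) * B   ≡⟨ cong (λ b → (1 + b * B) * B) b≡2h+1 ⟩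
        (1 + suc (h + h) * B) * B                 ≡⟨ regroup B h ⟩
        (B * B + B) + (h * B * B + h * B * B)     ≡⟨ cong (_+ (h * B * B + h * B * B)) B²+B≡2g ⟩
        (g + g) + (h * B * B + h * B * B)         ≡⟨ halve g (h * B * B) ⟩
        (g + h * B * B) + (g + h * B * B)         ∎)
      where
      regroup : ∀ B h → (1 + suc (h + h) * B) * B ≡ (B * B + B) + (h * B * B + h * B * B)
      regroup = ℕ-Solver.solve-∀
      halve : ∀ g t → (g + g) + (t + t) ≡ (g + t) + (g + t)
      halve = ℕ-Solver.solve-∀

  -- S(1 + B + B² + B³ i + B⁴ i) = 1 + 1 + 1 - 1 - 1.
  large-happy : ∀ M → ∃[ a ] ∃[ W ] M ≤ W × S B ⟨ a , W + W ⟩ ≡ oneᵍ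
  large-happy M with n*n+n-even B
  ... | zero , B²+B≡0 = ⊥-elim (ℕ.<⇒≢ 0<B (sym (ℕ.m+n≡0⇒n≡0 (B * B) B²+B≡0)))
  ... | g@(suc _) , B²+B≡2g = B ^ M * proj₁ (fromDigits ds) , B ^ M * (B * B * g) , M≤W , (begin
      S B ⟨ B ^ M * proj₁ (fromDigits ds) , B ^ M * (B * B * g) + B ^ M * (B * B * g) ⟩
    ≡⟨ cong (λ b → S B ⟨ B ^ M * proj₁ (fromDigits ds) , b ⟩) b≡2W ⟩
      S B ⟨ B ^ M * proj₁ (fromDigits ds) , B ^ M * proj₂ (fromDigits ds) ⟩
    ≡⟨ S-shift M (proj₁ (fromDigits ds)) (proj₂ (fromDigits ds)) ⟩
      S B (uncurry ⟨_,_⟩ (fromDigits ds))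
    ≡⟨ S-fromDigits ds ((1<B , 0<B) ∷ (1<B , 0<B) ∷ (1<B , 0<B) ∷ (0<B , 1<B) ∷ (0<B , 1<B) ∷ []) ⟩
      oneᵍ
    ∎)
    where
    open ≡-Reasoning
    ds : List (ℕ × ℕ)
    ds = (1 , 0) ∷ (1 , 0) ∷ (1 , 0) ∷ (0 , 1) ∷ (0 , 1) ∷ []
    b≡2W : B ^ M * (B * B * g) + B ^ M * (B * B * g) ≡ B ^ M * proj₂ (fromDigits ds)
    b≡2W = begin
        B ^ M * (B * B * g) + B ^ M * (B * B * g)     ≡⟨ sym (ℕ.*-distribˡ-+ (B ^ M) (B * B * g) (B * B * g)) ⟩
        B ^ M * (B * B * g + B * B * g)               ≡⟨ cong (B ^ M *_) (sym (ℕ.*-distribˡ-+ (B * B) g g)) ⟩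
        B ^ M * (B * B * (g + g))                     ≡⟨ cong (λ t → B ^ M * (B * B * t)) (sym B²+B≡2g) ⟩
        B ^ M * (B * B * (B * B + B))                 ≡⟨ cong (B ^ M *_) (expand B) ⟩
        B ^ M * proj₂ (fromDigits ds)                 ∎
      where
      expand : ∀ B → B * B * (B * B + B) ≡ 0 + (0 + (0 + (1 + (1 + 0 * B) * B) * B) * B) * B
      expand = ℕ-Solver.solve-∀
    M≤W : M ≤ B ^ M * (B * B * g)
    M≤W = ℕ.≤-trans (ℕ.<⇒≤ (n<B^n M)) (ℕ.m≤m*n (B ^ M) (B * B * g))
      where instance _ = ℕ.>-nonZero (ℕ.*-mono-≤ (ℕ.*-mono-≤ 0<B 0<B) (s≤s z≤n))

  representable-even : ∀ X W k → ∣ k ∣ ≤ W →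
                       ∃[ a ] ∃[ b ] Even b × S B ⟨ a , b ⟩ ≡ (X , + (W + W) ℤ.- (k ℤ.+ k))
  representable-even X W k ∣k∣≤W with natural-shift W (ℤ.- k) (subst (_≤ W) (sym (ℤ.∣-i∣≡∣i∣ k)) ∣k∣≤W)
  ... | n , W-k≡n , _ with representable X n
  ...   | a , b , b-even , S≡ = a , b , b-even , trans S≡ (cong (X ,_) (begin
      + (n + n)                        ≡⟨ ℤ.pos-+ n n ⟩
      + n ℤ.+ + n                      ≡⟨ cong₂ ℤ._+_ (sym W-k≡n) (sym W-k≡n) ⟩
      (+ W ℤ.- k) ℤ.+ (+ W ℤ.- k)      ≡⟨ regroup (+ W) k ⟩
      (+ W ℤ.+ + W) ℤ.- (k ℤ.+ k)      ≡⟨ cong (ℤ._- (k ℤ.+ k)) (sym (ℤ.pos-+ W W)) ⟩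
      + (W + W) ℤ.- (k ℤ.+ k)          ∎))
    where
    open ≡-Reasoning
    regroup : ∀ w k → (w ℤ.- k) ℤ.+ (w ℤ.- k) ≡ (w ℤ.+ w) ℤ.- (k ℤ.+ k)
    regroup = solve-∀

  S-re-parity : Odd B → ∀ a b → Evenℤ (proj₁ (S B ⟨ a , b ⟩) ℤ.+ (+ a ℤ.- + b))
  S-re-parity B-odd a b with Σsq+n-even B-odd a | Σsq+n-even B-odd b
  ... | h , Σa+a≡2h | j , Σb+b≡2j = + h ℤ.- + j , (begin
      proj₁ (S B ⟨ a , b ⟩) ℤ.+ (+ a ℤ.- + b)              ≡⟨ cong (λ z → proj₁ z ℤ.+ (+ a ℤ.- + b)) (S-re-im a b) ⟩
      (+ Σsq a ℤ.- + Σsq b) ℤ.+ (+ a ℤ.- + b)              ≡⟨ regroup (+ Σsq a) (+ Σsq b) (+ a) (+ b) ⟩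
      (+ Σsq a ℤ.+ + a) ℤ.- (+ Σsq b ℤ.+ + b)              ≡⟨ cong₂ ℤ._-_ (cast (Σsq a) a h Σa+a≡2h) (cast (Σsq b) b j Σb+b≡2j) ⟩
      (+ h ℤ.+ + h) ℤ.- (+ j ℤ.+ + j)                      ≡⟨ halve (+ h) (+ j) ⟩
      (+ h ℤ.- + j) ℤ.+ (+ h ℤ.- + j)                      ∎)
    where
    open ≡-Reasoning
    regroup : ∀ s t a b → (s ℤ.- t) ℤ.+ (a ℤ.- b) ≡ (s ℤ.+ a) ℤ.- (t ℤ.+ b)
    regroup = solve-∀
    halve : ∀ h j → (h ℤ.+ h) ℤ.- (j ℤ.+ j) ≡ (h ℤ.- j) ℤ.+ (h ℤ.- j)
    halve = solve-∀
    cast : ∀ m n h → m + n ≡ h + h → + m ℤ.+ + n ≡ + h ℤ.+ + h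
    cast m n h eq = trans (sym (ℤ.pos-+ m n)) (trans (cong +_ eq) (ℤ.pos-+ h h))

  -- Reducing and merging finite sets of Gaussian integers

  EventuallyOne : ℤ[i] → Set
  EventuallyOne z = ∃[ k ] iter (S B) k z ≡ oneᵍ

  iter-S-suc : ∀ k z → iter (S B) (suc k) z ≡ iter (S B) k (S B z)
  iter-S-suc zero    z = refl
  iter-S-suc (suc k) z = cong (S B) (iter-S-suc k z)

  EventuallyOne-S⁻ : ∀ z → EventuallyOne (S B z) → EventuallyOne z
  EventuallyOne-S⁻ z (k , Sᵏ⁺¹z≡1) = suc k , trans (iter-S-suc k z) Sᵏ⁺¹z≡1

  GaussHappy-S⁻ : ∀ z → EventuallyOne (S B z) → GaussHappy B z
  GaussHappy-S⁻ z (k , Sᵏ⁺¹z≡1) = k , trans (iter-S-suc k z) Sᵏ⁺¹z≡1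

  record ParityCompatible (U : List ℤ[i]) : Set where
    field
      im-even : ∀ {u} → u ∈ U → Evenℤ (proj₂ u)
      re-congruent : Odd B → ∀ {u v} → u ∈ U → v ∈ U → Evenℤ (proj₁ u ℤ.- proj₁ v)

  HasHappyTranslate : List ℤ[i] → Set
  HasHappyTranslate U = ∃[ a ] ∃[ b ] Even b × (∀ {u} → u ∈ U → EventuallyOne (S B ⟨ a , b ⟩ +ᵍ u))

  record Reduction (U : List ℤ[i]) (f : ℤ[i] → ℤ[i]) : Set where
    field
      parity : ParityCompatible (map f U)
      reflect : HasHappyTranslate (map f U) → HasHappyTranslate U

  Reduction-id : ∀ {U} → ParityCompatible U → Reduction U id
  Reduction-id {U} compatible = record
    { parity = subst ParityCompatible (sym (List.map-id U)) compatible
    ; reflect = subst HasHappyTranslate (List.map-id U) }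

  Reduction-∘ : ∀ {U f g} → Reduction U f → Reduction (map f U) g → Reduction U (g ∘ f)
  Reduction-∘ {U} {f} {g} f-red g-red = record
    { parity = subst ParityCompatible (sym (List.map-∘ U)) (Reduction.parity g-red)
    ; reflect = λ h → Reduction.reflect f-red (Reduction.reflect g-red (subst HasHappyTranslate (List.map-∘ U) h)) }

  Merge : List ℤ[i] → ℤ[i] → ℤ[i] → Set
  Merge U u₁ u₂ = ∃[ f ] Reduction U f × f u₁ ≡ f u₂

  Merge-sym : ∀ {U u₁ u₂} → Merge U u₁ u₂ → Merge U u₂ u₁
  Merge-sym (f , f-red , eq) = f , f-red , sym eq

  Merge-refl : ∀ {U u₁ u₂} → ParityCompatible U → u₁ ≡ u₂ → Merge U u₁ u₂
  Merge-refl compatible u₁≡u₂ = id , Reduction-id compatible , u₁≡u₂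

  Merge-after : ∀ {U u₁ u₂ f} → Reduction U f → Merge (map f U) (f u₁) (f u₂) → Merge U u₁ u₂
  Merge-after {f = f} f-red (g , g-red , eq) = g ∘ f , Reduction-∘ f-red g-red , eq

  module Step {U : List ℤ[i]} {u₀ : ℤ[i]} (compatible : ParityCompatible U) (u₀∈U : u₀ ∈ U)
              (s₁ s₂ N : ℕ) (s₂-even : Even B → Even s₂) where

    open ParityCompatible compatible

    K : ℕ
    K = bound U + bound U

    M : ℕ
    M = suc N

    K₂-choice : ∃[ K₂ ] K ≤ K₂ × Even (s₂ + B ^ M * K₂)
    K₂-choice with even-or-odd B
    ... | inj₁ (k , B≡2k) with s₂-even (k , B≡2k)
    ...   | h , s₂≡2h = K , ℕ.≤-refl , h + k * B ^ N * K , (begin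
        s₂ + B * B ^ N * K                     ≡⟨ cong₂ (λ s b → s + b * B ^ N * K) s₂≡2h B≡2k ⟩
        h + h + (k + k) * B ^ N * K            ≡⟨ halve h k (B ^ N) K ⟩
        (h + k * B ^ N * K) + (h + k * B ^ N * K) ∎)
      where
      open ≡-Reasoning
      halve : ∀ h k P K → h + h + (k + k) * P * K ≡ (h + k * P * K) + (h + k * P * K)
      halve = ℕ-Solver.solve-∀
    K₂-choice | inj₂ B-odd with Odd-^ B-odd M | even-or-odd (s₂ + B ^ M * K)
    ... | _ | inj₁ even = K , ℕ.≤-refl , even
    ... | j , B^M≡2j+1 | inj₂ (h , ≡2h+1) = suc K , ℕ.n≤1+n K , suc (h + j) , (begin
        s₂ + B ^ M * suc K                     ≡⟨ regroup s₂ (B ^ M) K ⟩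
        (s₂ + B ^ M * K) + B ^ M               ≡⟨ cong₂ _+_ ≡2h+1 B^M≡2j+1 ⟩
        suc (h + h) + suc (j + j)              ≡⟨ halve h j ⟩
        suc (h + j) + suc (h + j)              ∎)
      where
      open ≡-Reasoning
      regroup : ∀ s P K → s + P * suc K ≡ (s + P * K) + P
      regroup = ℕ-Solver.solve-∀
      halve : ∀ h j → suc (h + h) + suc (j + j) ≡ suc (h + j) + suc (h + j)
      halve = ℕ-Solver.solve-∀

    K₂ : ℕ
    K₂ = proj₁ K₂-choice

    y₁ y₂ : ℕ
    y₁ = s₁ + B ^ M * K
    y₂ = s₂ + B ^ M * K₂

    c : ℤ[i]
    c = ⟨ y₁ , y₂ ⟩ -ᵍ u₀

    f : ℤ[i] → ℤ[i]
    f u = S B (u +ᵍ c)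

    f-digits : ∀ {u t₁ t₂} → t₁ < B ^ N → t₂ < B ^ N → u -ᵍ u₀ ≡ ⟨ t₁ , t₂ ⟩ -ᵍ ⟨ s₁ , s₂ ⟩ →
               f u ≡ S B ⟨ K , K₂ ⟩ +ᵍ S B ⟨ t₁ , t₂ ⟩
    f-digits {u} {t₁} {t₂} t₁<B^N t₂<B^N u-u₀≡t-s = begin
        S B (u +ᵍ (⟨ y₁ , y₂ ⟩ -ᵍ u₀))
      ≡⟨ cong (λ y → S B (u +ᵍ (y -ᵍ u₀))) (sym (⟨⟩+ᵍ⟨⟩ s₁ s₂ (B ^ M * K) (B ^ M * K₂))) ⟩
        S B (u +ᵍ ((⟨ s₁ , s₂ ⟩ +ᵍ ⟨ B ^ M * K , B ^ M * K₂ ⟩) -ᵍ u₀))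
      ≡⟨ cong (S B) (translate-diff u u₀ ⟨ s₁ , s₂ ⟩ ⟨ t₁ , t₂ ⟩ ⟨ B ^ M * K , B ^ M * K₂ ⟩ u-u₀≡t-s) ⟩
        S B (⟨ t₁ , t₂ ⟩ +ᵍ ⟨ B ^ M * K , B ^ M * K₂ ⟩)
      ≡⟨ cong (S B) (⟨⟩+ᵍ⟨⟩ t₁ t₂ (B ^ M * K) (B ^ M * K₂)) ⟩
        S B ⟨ t₁ + B ^ M * K , t₂ + B ^ M * K₂ ⟩
      ≡⟨ S-concat M K K₂ t₁ t₂ (widen t₁<B^N) (widen t₂<B^N) ⟩
        S B ⟨ K , K₂ ⟩ +ᵍ S B ⟨ t₁ , t₂ ⟩
      ∎
      where
      open ≡-Reasoning
      widen : ∀ {t} → t < B ^ N → t < B ^ M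
      widen t<B^N = ℕ.<-≤-trans t<B^N (ℕ.m≤n*m (B ^ N) B {{ℕ.>-nonZero 0<B}})

    L : ℕ
    L = y₁ + y₂ + K

    K≤y₁ : K ≤ y₁
    K≤y₁ = ℕ.≤-trans (ℕ.m≤n*m K (B ^ M) {{ℕ.m^n≢0 B M}}) (ℕ.m≤n+m (B ^ M * K) s₁)

    K≤y₂ : K ≤ y₂
    K≤y₂ = ℕ.≤-trans (proj₁ (proj₂ K₂-choice))
             (ℕ.≤-trans (ℕ.m≤n*m K₂ (B ^ M) {{ℕ.m^n≢0 B M}}) (ℕ.m≤n+m (B ^ M * K₂) s₂))

    private
      ∣a-a₀∣≤K : ∀ a a₀ → ∣ a ∣ ≤ bound U → ∣ a₀ ∣ ≤ bound U → ∣ a ℤ.- a₀ ∣ ≤ K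
      ∣a-a₀∣≤K a a₀ ∣a∣≤ ∣a₀∣≤ = ℕ.≤-trans (ℤ.∣i-j∣≤∣i∣+∣j∣ a a₀) (ℕ.+-mono-≤ ∣a∣≤ ∣a₀∣≤)

      coordinate : ∀ y a a₀ → K ≤ y → ∣ a ∣ ≤ bound U → ∣ a₀ ∣ ≤ bound U →
                   ∃[ n ] a ℤ.+ (+ y ℤ.- a₀) ≡ + n × n ≤ y + K
      coordinate y a a₀ K≤y ∣a∣≤ ∣a₀∣≤
        with natural-shift y (a ℤ.- a₀) (ℕ.≤-trans (∣a-a₀∣≤K a a₀ ∣a∣≤ ∣a₀∣≤) K≤y)
      ... | n , y+[a-a₀]≡n , n≤ =
        n , trans (regroup a (+ y) a₀) y+[a-a₀]≡n , ℕ.≤-trans n≤ (ℕ.+-monoʳ-≤ y (∣a-a₀∣≤K a a₀ ∣a∣≤ ∣a₀∣≤))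
        where
        regroup : ∀ a w a₀ → a ℤ.+ (w ℤ.- a₀) ≡ w ℤ.+ (a ℤ.- a₀)
        regroup = solve-∀

      coordinates-bounded : ∀ {u} → u ∈ U → ∣ proj₁ u ∣ ≤ bound U × ∣ proj₂ u ∣ ≤ bound U
      coordinates-bounded {a , b} u∈U =
        ℕ.≤-trans (ℕ.m≤m+n ∣ a ∣ ∣ b ∣) (∣re∣+∣im∣≤bound u∈U) ,
        ℕ.≤-trans (ℕ.m≤n+m ∣ b ∣ ∣ a ∣) (∣re∣+∣im∣≤bound u∈U)

    record Shifted (u : ℤ[i]) : Set where
      constructor shifted
      field
        n₁ n₂ : ℕ
        u+c≡n : u +ᵍ c ≡ ⟨ n₁ , n₂ ⟩
        n₁≤L : n₁ ≤ L
        n₂≤L : n₂ ≤ L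

    shift : ∀ {u} → u ∈ U → Shifted u
    shift {a , b} u∈U
      with coordinates-bounded u∈U | coordinates-bounded u₀∈U
    ... | ∣a∣≤ , ∣b∣≤ | ∣a₀∣≤ , ∣b₀∣≤
      with coordinate y₁ a (proj₁ u₀) K≤y₁ ∣a∣≤ ∣a₀∣≤ | coordinate y₂ b (proj₂ u₀) K≤y₂ ∣b∣≤ ∣b₀∣≤
    ... | n₁ , eq₁ , n₁≤ | n₂ , eq₂ , n₂≤ =
      shifted n₁ n₂ (cong₂ _,_ eq₁ eq₂)
        (ℕ.≤-trans n₁≤ (ℕ.+-monoˡ-≤ K (ℕ.m≤m+n y₁ y₂)))
        (ℕ.≤-trans n₂≤ (ℕ.+-monoˡ-≤ K (ℕ.m≤n+m y₂ y₁)))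

    parity : ParityCompatible (map f U)
    parity = record { im-even = im-even′ ; re-congruent = re-congruent′ }
      where
      im-even′ : ∀ {u′} → u′ ∈ map f U → Evenℤ (proj₂ u′)
      im-even′ u′∈ with ∈-map⁻ f u′∈
      ... | u , u∈U , refl with shift u∈U
      ... | shifted n₁ n₂ u+c≡n _ _ = subst (λ z → Evenℤ (proj₂ (S B z))) (sym u+c≡n) (S-im-even n₁ n₂)

      -- Re S⟨n₁,n₂⟩ ≡ n₁ - n₂ (mod 2), and n₁ - m₁, n₂ - m₂ are the coordinate differences of u - v.
      re-congruent′ : Odd B → ∀ {u′ v′} → u′ ∈ map f U → v′ ∈ map f U → Evenℤ (proj₁ u′ ℤ.- proj₁ v′)
      re-congruent′ B-odd u′∈ v′∈ with ∈-map⁻ f u′∈ | ∈-map⁻ f v′∈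
      ... | u , u∈U , refl | v , v∈U , refl with shift u∈U | shift v∈U
      ... | shifted n₁ n₂ u+c≡n _ _ | shifted m₁ m₂ v+c≡m _ _ =
        subst (λ (p : ℤ[i] × ℤ[i]) → Evenℤ (proj₁ (S B (proj₁ p)) ℤ.- proj₁ (S B (proj₂ p))))
              (sym (cong₂ _,_ u+c≡n v+c≡m))
              (subst Evenℤ (regroup (proj₁ (S B ⟨ n₁ , n₂ ⟩)) (proj₁ (S B ⟨ m₁ , m₂ ⟩)) (+ n₁) (+ n₂) (+ m₁) (+ m₂))
                (Evenℤ-difference (Evenℤ-difference (S-re-parity B-odd n₁ n₂) (S-re-parity B-odd m₁ m₂))
                         (Evenℤ-difference (subst Evenℤ (sym (cong proj₁ n-m≡u-v)) (re-congruent B-odd u∈U v∈U))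
                                  (subst Evenℤ (sym (cong proj₂ n-m≡u-v)) (Evenℤ-difference (im-even u∈U) (im-even v∈U))))))
        where
        n-m≡u-v : ⟨ n₁ , n₂ ⟩ -ᵍ ⟨ m₁ , m₂ ⟩ ≡ u -ᵍ v
        n-m≡u-v = trans (cong₂ _-ᵍ_ (sym u+c≡n) (sym v+c≡m)) ([z+c]-[w+c]≡z-w u v c)
        regroup : ∀ R R′ n₁ n₂ m₁ m₂ →
                  ((R ℤ.+ (n₁ ℤ.- n₂)) ℤ.- (R′ ℤ.+ (m₁ ℤ.- m₂))) ℤ.- ((n₁ ℤ.- m₁) ℤ.- (n₂ ℤ.- m₂)) ≡ R ℤ.- R′
        regroup = solve-∀

    -- Prepending the digits of (a′, b′) above position L to u + c turns a happy translate of f[U] into one of U.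
    reflect : HasHappyTranslate (map f U) → HasHappyTranslate U
    reflect (a′ , b′ , (hb , b′≡2hb) , happy) = a , b , b-even , λ u∈U →
      EventuallyOne-S⁻ _ (subst EventuallyOne (sym (S-translate u∈U)) (happy (∈-map⁺ f u∈U)))
      where
      h₂ = proj₁ (proj₂ (proj₂ K₂-choice))
      y₂≡2h₂ : y₂ ≡ h₂ + h₂
      y₂≡2h₂ = proj₂ (proj₂ (proj₂ K₂-choice))
      ia = proj₁ (im-even u₀∈U)
      W = B ^ L * hb + h₂
      ∣ia∣≤W : ∣ ia ∣ ≤ W
      ∣ia∣≤W = begin
          ∣ ia ∣                  ≤⟨ ∣k∣≤∣k+k∣ ia ⟩
          ∣ ia ℤ.+ ia ∣           ≡⟨ cong ∣_∣ (sym (proj₂ (im-even u₀∈U))) ⟩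
          ∣ proj₂ u₀ ∣            ≤⟨ proj₂ (coordinates-bounded u₀∈U) ⟩
          bound U                 ≤⟨ half-≤ (bound U) h₂ (subst (K ≤_) y₂≡2h₂ K≤y₂) ⟩
          h₂                      ≤⟨ ℕ.m≤n+m h₂ (B ^ L * hb) ⟩
          W                       ∎
        where open ℕ.≤-Reasoning
      P : ℤ[i]
      P = ⟨ B ^ L * a′ , B ^ L * b′ ⟩
      im-target : + (W + W) ℤ.- (ia ℤ.+ ia) ≡ proj₂ (P +ᵍ c)
      im-target = begin
          + (W + W) ℤ.- (ia ℤ.+ ia)
        ≡⟨ cong (ℤ._- (ia ℤ.+ ia)) (cast (B ^ L * hb) h₂) ⟩
          (+ (B ^ L * hb) ℤ.+ + h₂) ℤ.+ (+ (B ^ L * hb) ℤ.+ + h₂) ℤ.- (ia ℤ.+ ia)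
        ≡⟨ regroup (+ (B ^ L * hb)) (+ h₂) ia ⟩
          (+ (B ^ L * hb) ℤ.+ + (B ^ L * hb)) ℤ.+ ((+ h₂ ℤ.+ + h₂) ℤ.- (ia ℤ.+ ia))
        ≡⟨ cong₂ (λ p q → p ℤ.+ (q ℤ.- (ia ℤ.+ ia))) (sym (ℤ.pos-+ (B ^ L * hb) (B ^ L * hb))) (sym (ℤ.pos-+ h₂ h₂)) ⟩
          + (B ^ L * hb + B ^ L * hb) ℤ.+ (+ (h₂ + h₂) ℤ.- (ia ℤ.+ ia))
        ≡⟨ cong₂ (λ p q → + p ℤ.+ (+ q ℤ.- (ia ℤ.+ ia))) (sym (ℕ.*-distribˡ-+ (B ^ L) hb hb)) (sym y₂≡2h₂) ⟩
          + (B ^ L * (hb + hb)) ℤ.+ (+ y₂ ℤ.- (ia ℤ.+ ia))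
        ≡⟨ cong₂ (λ p q → + (B ^ L * p) ℤ.+ (+ y₂ ℤ.- q)) (sym b′≡2hb) (sym (proj₂ (im-even u₀∈U))) ⟩
          + (B ^ L * b′) ℤ.+ (+ y₂ ℤ.- proj₂ u₀)
        ∎
        where
        open ≡-Reasoning
        cast : ∀ p h → + ((p + h) + (p + h)) ≡ (+ p ℤ.+ + h) ℤ.+ (+ p ℤ.+ + h)
        cast p h = trans (ℤ.pos-+ (p + h) (p + h)) (cong₂ ℤ._+_ (ℤ.pos-+ p h) (ℤ.pos-+ p h))
        regroup : ∀ p h i → (p ℤ.+ h) ℤ.+ (p ℤ.+ h) ℤ.- (i ℤ.+ i) ≡ (p ℤ.+ p) ℤ.+ ((h ℤ.+ h) ℤ.- (i ℤ.+ i))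
        regroup = solve-∀
      representation = representable-even (proj₁ (P +ᵍ c)) W ia ∣ia∣≤W
      a = proj₁ representation
      b = proj₁ (proj₂ representation)
      b-even = proj₁ (proj₂ (proj₂ representation))
      S⟨a,b⟩≡P+c : S B ⟨ a , b ⟩ ≡ P +ᵍ c
      S⟨a,b⟩≡P+c = trans (proj₂ (proj₂ (proj₂ representation))) (cong (proj₁ (P +ᵍ c) ,_) im-target)
      S-translate : ∀ {u} → u ∈ U → S B (S B ⟨ a , b ⟩ +ᵍ u) ≡ S B ⟨ a′ , b′ ⟩ +ᵍ f u
      S-translate {u} u∈U with shift u∈U
      ... | shifted n₁ n₂ u+c≡n n₁≤L n₂≤L = begin
          S B (S B ⟨ a , b ⟩ +ᵍ u)                         ≡⟨ cong (λ z → S B (z +ᵍ u)) S⟨a,b⟩≡P+c ⟩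
          S B ((P +ᵍ c) +ᵍ u)                              ≡⟨ cong (S B) (trans (+ᵍ-assoc P c u) (cong (P +ᵍ_) (+ᵍ-comm c u))) ⟩
          S B (P +ᵍ (u +ᵍ c))                              ≡⟨ cong (λ z → S B (P +ᵍ z)) u+c≡n ⟩
          S B (P +ᵍ ⟨ n₁ , n₂ ⟩)                           ≡⟨ cong (S B) (trans (+ᵍ-comm P ⟨ n₁ , n₂ ⟩) (⟨⟩+ᵍ⟨⟩ n₁ n₂ _ _)) ⟩
          S B ⟨ n₁ + B ^ L * a′ , n₂ + B ^ L * b′ ⟩         ≡⟨ S-concat L a′ b′ n₁ n₂ (<B^L n₁≤L) (<B^L n₂≤L) ⟩
          S B ⟨ a′ , b′ ⟩ +ᵍ S B ⟨ n₁ , n₂ ⟩                ≡⟨ cong (λ z → S B ⟨ a′ , b′ ⟩ +ᵍ S B z) (sym u+c≡n) ⟩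
          S B ⟨ a′ , b′ ⟩ +ᵍ f u                            ∎
        where
        open ≡-Reasoning
        <B^L : ∀ {n} → n ≤ L → n < B ^ L
        <B^L n≤L = ℕ.≤-<-trans n≤L (n<B^n L)

  step : ∀ {U u₁ u₂} → ParityCompatible U → u₁ ∈ U →
         ∀ N s₁ s₂ t₁ t₂ → (Even B → Even s₂) → s₁ < B ^ N → s₂ < B ^ N → t₁ < B ^ N → t₂ < B ^ N →
         u₂ -ᵍ u₁ ≡ ⟨ t₁ , t₂ ⟩ -ᵍ ⟨ s₁ , s₂ ⟩ →
         ∃[ f ] Reduction U f × f u₂ -ᵍ f u₁ ≡ S B ⟨ t₁ , t₂ ⟩ -ᵍ S B ⟨ s₁ , s₂ ⟩
  step {U} {u₁} {u₂} compatible u₁∈U N s₁ s₂ t₁ t₂ s₂-even s₁< s₂< t₁< t₂< u₂-u₁≡t-s =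
    f , record { parity = parity ; reflect = reflect } , (begin
      f u₂ -ᵍ f u₁
    ≡⟨ cong₂ _-ᵍ_ (f-digits {u₂} t₁< t₂< u₂-u₁≡t-s) (f-digits {u₁} s₁< s₂< (trans (z-z≡0 u₁) (sym (z-z≡0 ⟨ s₁ , s₂ ⟩)))) ⟩
      (S B ⟨ K , K₂ ⟩ +ᵍ S B ⟨ t₁ , t₂ ⟩) -ᵍ (S B ⟨ K , K₂ ⟩ +ᵍ S B ⟨ s₁ , s₂ ⟩)
    ≡⟨ [c+t]-[c+s]≡t-s (S B ⟨ K , K₂ ⟩) (S B ⟨ s₁ , s₂ ⟩) (S B ⟨ t₁ , t₂ ⟩) ⟩
      S B ⟨ t₁ , t₂ ⟩ -ᵍ S B ⟨ s₁ , s₂ ⟩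
    ∎)
    where
    open ≡-Reasoning
    open Step compatible u₁∈U s₁ s₂ N s₂-even

  Mergeable : (ℤ[i] → Set) → Set
  Mergeable C = ∀ {U u₁ u₂} → ParityCompatible U → u₁ ∈ U → u₂ ∈ U → C (u₂ -ᵍ u₁) → Merge U u₁ u₂

  negate-diff : ∀ u₁ u₂ {a b} → u₂ -ᵍ u₁ ≡ (a , b) → u₁ -ᵍ u₂ ≡ (ℤ.- a , ℤ.- b)
  negate-diff u₁ u₂ eq = trans (z-w≡-[w-z] u₁ u₂) (cong -ᵍ_ eq)

  RealMultipleOfB-1 : ℤ[i] → Set
  RealMultipleOfB-1 d = ∃[ k ] d ≡ (k ℤ.* + B-1 , + 0)

  private
    -- Multiplying by B leaves S unchanged and changes the real part by a multiple of B - 1.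
    merge-nonneg-multiple : ∀ {U u₁ u₂} → ParityCompatible U → u₁ ∈ U → ∀ g →
                            u₂ -ᵍ u₁ ≡ (+ g ℤ.* + B-1 , + 0) → Merge U u₁ u₂
    merge-nonneg-multiple {U} {u₁} {u₂} compatible u₁∈U g d≡ge with
      step compatible u₁∈U (B * g) g 0 (B * g) 0 (λ _ → 0 , refl)
           (ℕ.≤-<-trans (ℕ.m≤n*m g B {{ℕ.>-nonZero 0<B}}) (n<B^n (B * g))) (B^n>0 (B * g))
           (n<B^n (B * g)) (B^n>0 (B * g)) (trans d≡ge (cong (_, + 0) ge≡Bg-g))
      where
      ge≡Bg-g : + g ℤ.* + B-1 ≡ + (B * g) ℤ.- + g
      ge≡Bg-g = begin
          + g ℤ.* + B-1                    ≡⟨ expand (+ g) (+ B-1) ⟩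
          (+ 1 ℤ.+ + B-1) ℤ.* + g ℤ.- + g  ≡⟨ cong (λ b → b ℤ.* + g ℤ.- + g) (sym (cong +_ B≡1+B-1)) ⟩
          + B ℤ.* + g ℤ.- + g              ≡⟨ cong (ℤ._- + g) (sym (ℤ.pos-* B g)) ⟩
          + (B * g) ℤ.- + g                ∎
        where
        open ≡-Reasoning
        expand : ∀ g e → g ℤ.* e ≡ (+ 1 ℤ.+ e) ℤ.* g ℤ.- g
        expand = solve-∀
    ... | f , f-red , fu₂-fu₁≡ = f , f-red , sym (z-w≡0⇒z≡w (f u₂) (f u₁) (trans fu₂-fu₁≡ (begin
        S B ⟨ B * g , 0 ⟩ -ᵍ S B ⟨ g , 0 ⟩
      ≡⟨ cong (λ z → z -ᵍ S B ⟨ g , 0 ⟩) (trans (cong₂ (λ a b → S B ⟨ a , b ⟩)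
              (cong (_* g) (sym (ℕ.*-identityʳ B))) (sym (ℕ.*-zeroʳ (B ^ 1)))) (S-shift 1 g 0)) ⟩
        S B ⟨ g , 0 ⟩ -ᵍ S B ⟨ g , 0 ⟩
      ≡⟨ z-z≡0 (S B ⟨ g , 0 ⟩) ⟩
        0ᵍ
      ∎)))
      where open ≡-Reasoning

  merge-multiple-of-B-1 : Mergeable RealMultipleOfB-1
  merge-multiple-of-B-1 compatible u₁∈U u₂∈U (+ g , d≡ge) = merge-nonneg-multiple compatible u₁∈U g d≡ge
  merge-multiple-of-B-1 {U} {u₁} {u₂} compatible u₁∈U u₂∈U (-[1+ g ] , d≡ge) =
    Merge-sym (merge-nonneg-multiple compatible u₂∈U (suc g)
      (trans (negate-diff u₁ u₂ d≡ge) (cong (_, + 0) (ℤ.neg-distribˡ-* -[1+ g ] (+ B-1)))))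

  Real : ℤ[i] → Set
  Real d = ∃[ r ] d ≡ (r , + 0)

  private
    -- x = (P - R) + P c and y = x + R = P (c + 1), with c chosen so that Σsq y ≡ Σsq x (mod B - 1).
    merge-positive-real : ∀ {U u₁ u₂} → ParityCompatible U → u₁ ∈ U → u₂ ∈ U → ∀ r →
                          u₂ -ᵍ u₁ ≡ (+ suc r , + 0) → Merge U u₁ u₂
    merge-positive-real {U} {u₁} {u₂} compatible u₁∈U u₂∈U r d≡R =
      merge-with-digit (odd-residue (Σsq r) Σsq-r-odd-or-B-even)
      where
      R = suc r
      P = B ^ R
      Σsq-r-odd-or-B-even : Even B ⊎ Odd (Σsq r)
      Σsq-r-odd-or-B-even with even-or-odd B
      ... | inj₁ B-even = inj₁ B-even
      ... | inj₂ B-odd = inj₂ (Even-+-Odd⇒Odd (Σsq r) (Σsq+n-even B-odd r)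
                                (Even-suc⇒Odd (Evenℤ⇒Even (subst Evenℤ (cong proj₁ d≡R)
                                  (ParityCompatible.re-congruent compatible B-odd u₂∈U u₁∈U)))))

      merge-with-digit : ∃[ c ] suc c < B × ∃[ k ] + suc (c + c) ℤ.- + Σsq r ≡ k ℤ.* + B-1 → Merge U u₁ u₂
      merge-with-digit (c , suc-c<B , k₂ , 2c+1-Σsq-r≡k₂[B-1]) with Σsq-gap r c suc-c<B
      ... | k₁ , gap =
        Merge-after f-red (merge-multiple-of-B-1 (Reduction.parity f-red) (∈-map⁺ f u₁∈U) (∈-map⁺ f u₂∈U)
          (k₂ ℤ.- k₁ , trans fu₂-fu₁≡ (trans (cong₂ _-ᵍ_ (S-real y) (S-real x)) (cong₂ _,_ re-gap refl))))
        where
        x = (P ∸ R) + P * c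
        y = P * suc c
        x+R≡y : x + R ≡ y
        x+R≡y = trans (regroup (P ∸ R) (P * c) R) (trans (cong (_+ P * c) (ℕ.m∸n+n≡m (ℕ.<⇒≤ (n<B^n R)))) (sym (ℕ.*-suc P c)))
          where
          regroup : ∀ a b c → a + b + c ≡ a + c + b
          regroup = ℕ-Solver.solve-∀
        y<B^[R+1] : y < B ^ suc R
        y<B^[R+1] = subst (y <_) (ℕ.*-comm P B) (ℕ.*-monoʳ-< P {{ℕ.m^n≢0 B R}} suc-c<B)
        x<B^[R+1] : x < B ^ suc R
        x<B^[R+1] = ℕ.<-trans (subst (x <_) x+R≡y (ℕ.m<m+n x (s≤s z≤n))) y<B^[R+1]
        R≡y-x : + R ≡ + y ℤ.- + x
        R≡y-x = trans (sym (cancel (+ x) (+ R))) (cong (λ z → + z ℤ.- + x) x+R≡y)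
          where
          cancel : ∀ x r → (x ℤ.+ r) ℤ.- x ≡ r
          cancel = solve-∀
        stepped = step {u₂ = u₂} compatible u₁∈U (suc R) x 0 y 0 (λ _ → 0 , refl) x<B^[R+1] (B^n>0 (suc R))
                       y<B^[R+1] (B^n>0 (suc R)) (trans d≡R (cong (_, + 0) R≡y-x))
        f = proj₁ stepped
        f-red = proj₁ (proj₂ stepped)
        fu₂-fu₁≡ = proj₂ (proj₂ stepped)
        re-gap : + Σsq y ℤ.- + Σsq x ≡ (k₂ ℤ.- k₁) ℤ.* + B-1
        re-gap = trans gap (trans (cong (ℤ._- k₁ ℤ.* + B-1) 2c+1-Σsq-r≡k₂[B-1]) (factor k₂ k₁ (+ B-1)))
          where
          factor : ∀ k₂ k₁ e → k₂ ℤ.* e ℤ.- k₁ ℤ.* e ≡ (k₂ ℤ.- k₁) ℤ.* e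
          factor = solve-∀

  merge-real : Mergeable Real
  merge-real compatible u₁∈U u₂∈U (+ zero , d≡0) =
    Merge-refl compatible (sym (z-w≡0⇒z≡w _ _ d≡0))
  merge-real compatible u₁∈U u₂∈U (+ suc r , d≡R) =
    merge-positive-real compatible u₁∈U u₂∈U r d≡R
  merge-real {u₁ = u₁} {u₂} compatible u₁∈U u₂∈U (-[1+ r ] , d≡-R) =
    Merge-sym (merge-positive-real compatible u₂∈U u₁∈U r (negate-diff u₁ u₂ d≡-R))

  FirstQuadrant : ℤ[i] → Set
  FirstQuadrant d = ∃[ p ] ∃[ q ] d ≡ ⟨ p , q ⟩

  -- With P = B^(p+q), both S⟨P, q⟩ = 1 - Σsq q and S⟨P - p, 0⟩ are real.
  merge-first-quadrant : Mergeable FirstQuadrant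
  merge-first-quadrant {U} {u₁} {u₂} compatible u₁∈U u₂∈U (p , q , d≡pq) =
    Merge-after f-red (merge-real (Reduction.parity f-red) (∈-map⁺ f u₁∈U) (∈-map⁺ f u₂∈U)
      (_ , trans fu₂-fu₁≡ (cong₂ _,_ refl (cong₂ (λ a b → proj₂ a ℤ.- proj₂ b) S⟨P,q⟩≡ (S-real (P ∸ p))))))
    where
    L = p + q
    P = B ^ L
    P<B^[L+1] : P < B ^ suc L
    P<B^[L+1] = ℕ.^-monoʳ-< B 1<B (ℕ.n<1+n L)
    p≤P : p ≤ P
    p≤P = ℕ.≤-trans (ℕ.m≤m+n p q) (ℕ.<⇒≤ (n<B^n L))
    q<P : q < P
    q<P = ℕ.≤-<-trans (ℕ.m≤n+m q p) (n<B^n L)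
    d≡t-s : u₂ -ᵍ u₁ ≡ ⟨ P , q ⟩ -ᵍ ⟨ P ∸ p , 0 ⟩
    d≡t-s = trans d≡pq (cong₂ _,_ (trans (sym (cancel (+ (P ∸ p)) (+ p))) (cong (λ z → + z ℤ.- + (P ∸ p)) (ℕ.m∸n+n≡m p≤P)))
                                  (sym (ℤ.+-identityʳ (+ q))))
      where
      cancel : ∀ x r → (x ℤ.+ r) ℤ.- x ≡ r
      cancel = solve-∀
    stepped = step {u₂ = u₂} compatible u₁∈U (suc L) (P ∸ p) 0 P q (λ _ → 0 , refl)
                   (ℕ.≤-<-trans (ℕ.m∸n≤m P p) P<B^[L+1]) (B^n>0 (suc L)) P<B^[L+1] (ℕ.<-trans q<P P<B^[L+1]) d≡t-s
    f = proj₁ stepped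
    f-red = proj₁ (proj₂ stepped)
    fu₂-fu₁≡ = proj₂ (proj₂ stepped)
    S⟨P,q⟩≡ : S B ⟨ P , q ⟩ ≡ oneᵍ +ᵍ (ℤ.- + Σsq q , + 0)
    S⟨P,q⟩≡ = begin
        S B ⟨ P , q ⟩                                ≡⟨ cong₂ (λ a b → S B ⟨ a , b ⟩) (sym (ℕ.*-identityʳ P)) (sym (ℕ.+-identityʳ q)) ⟩
        S B ⟨ P * 1 , q + 0 ⟩                        ≡⟨ cong (λ b → S B ⟨ P * 1 , q + b ⟩) (sym (ℕ.*-zeroʳ P)) ⟩
        S B ⟨ 0 + P * 1 , q + P * 0 ⟩                ≡⟨ S-concat L 1 0 0 q (B^n>0 L) q<P ⟩
        S B ⟨ 1 , 0 ⟩ +ᵍ S B ⟨ 0 , q ⟩               ≡⟨ cong₂ _+ᵍ_ (S-digit 1 0 1<B 0<B) (S-imag q) ⟩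
        oneᵍ +ᵍ (ℤ.- + Σsq q , + 0)                  ∎
      where open ≡-Reasoning

  -- B² - 1 = (B - 1) + (B - 1) B has the two digits B - 1.
  S⟨x+P[B²-1],P⟩ : ∀ L x → x < B ^ L →
                   S B ⟨ x + B ^ L * (B-1 + B * B-1) , B ^ L ⟩ ≡
                   (+ (B-1 * B-1 + B-1 * B-1 + Σsq x) ℤ.- + 1 , + (B-1 + B-1))
  S⟨x+P[B²-1],P⟩ L x x<B^L = begin
      S B ⟨ x + B ^ L * (B-1 + B * B-1) , B ^ L ⟩
    ≡⟨ cong (λ b → S B ⟨ x + B ^ L * (B-1 + B * B-1) , b ⟩) (sym (ℕ.*-identityʳ (B ^ L))) ⟩
      S B ⟨ x + B ^ L * (B-1 + B * B-1) , 0 + B ^ L * 1 ⟩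
    ≡⟨ S-concat L (B-1 + B * B-1) 1 x 0 x<B^L (B^n>0 L) ⟩
      S B ⟨ B-1 + B * B-1 , 1 ⟩ +ᵍ S B ⟨ x , 0 ⟩
    ≡⟨ cong (λ a → S B ⟨ B-1 + a , 1 ⟩ +ᵍ S B ⟨ x , 0 ⟩) (ℕ.*-comm B B-1) ⟩
      S B ⟨ B-1 + B-1 * B , 1 + 0 * B ⟩ +ᵍ S B ⟨ x , 0 ⟩
    ≡⟨ cong (_+ᵍ S B ⟨ x , 0 ⟩) (S-digit-step B-1 1 B-1 0 B-1<B 1<B) ⟩
      (sq ⟨ B-1 , 1 ⟩ +ᵍ S B ⟨ B-1 , 0 ⟩) +ᵍ S B ⟨ x , 0 ⟩
    ≡⟨ cong₂ (λ a b → (sq ⟨ B-1 , 1 ⟩ +ᵍ a) +ᵍ b)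
             (trans (S-real B-1) (cong (λ n → (+ n , + 0)) (Σsq-digit B-1 B-1<B))) (S-real x) ⟩
      (sq ⟨ B-1 , 1 ⟩ +ᵍ (+ (B-1 * B-1) , + 0)) +ᵍ (+ Σsq x , + 0)
    ≡⟨ cong₂ _,_ (trans (cong (λ e → (e ℤ.- + 1 ℤ.* + 1 ℤ.+ + (B-1 * B-1)) ℤ.+ + Σsq x) (sym (ℤ.pos-* B-1 B-1)))
                        (re (+ (B-1 * B-1)) (+ Σsq x)))
                 (trans (im (+ B-1)) (sym (ℤ.pos-+ B-1 B-1))) ⟩
      (+ (B-1 * B-1 + B-1 * B-1 + Σsq x) ℤ.- + 1 , + (B-1 + B-1))
    ∎
    where
    open ≡-Reasoning
    B-1<B : B-1 < B
    B-1<B = subst (B-1 <_) (sym B≡1+B-1) (ℕ.n<1+n B-1)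
    re : ∀ E X → (E ℤ.- + 1 ℤ.* + 1 ℤ.+ E) ℤ.+ X ≡ (E ℤ.+ E ℤ.+ X) ℤ.- + 1
    re = solve-∀
    im : ∀ e → (e ℤ.* + 1 ℤ.+ + 1 ℤ.* e) ℤ.+ + 0 ℤ.+ + 0 ≡ e ℤ.+ e
    im = solve-∀

  S⟨PB²,y⟩ : ∀ L y → y < B ^ L → S B ⟨ B ^ L * (B * B) , y ⟩ ≡ (+ 1 ℤ.- + Σsq y , + 0)
  S⟨PB²,y⟩ L y y<B^L = begin
      S B ⟨ B ^ L * (B * B) , y ⟩
    ≡⟨ cong (λ b → S B ⟨ B ^ L * (B * B) , b ⟩) (sym (trans (cong (λ z → y + z) (ℕ.*-zeroʳ (B ^ L))) (ℕ.+-identityʳ y))) ⟩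
      S B ⟨ 0 + B ^ L * (B * B) , y + B ^ L * 0 ⟩
    ≡⟨ S-concat L (B * B) 0 0 y (B^n>0 L) y<B^L ⟩
      S B ⟨ B * B , 0 ⟩ +ᵍ S B ⟨ 0 , y ⟩
    ≡⟨ cong₂ _+ᵍ_ S⟨B²,0⟩≡1 (S-imag y) ⟩
      (+ 1 ℤ.+ ℤ.- + Σsq y , + 0)
    ∎
    where
    open ≡-Reasoning
    S⟨B²,0⟩≡1 : S B ⟨ B * B , 0 ⟩ ≡ oneᵍ
    S⟨B²,0⟩≡1 = trans (cong₂ (λ a b → S B ⟨ a , b ⟩) (regroup B) (sym (ℕ.*-zeroʳ (B ^ 2))))
                      (trans (S-shift 2 1 0) (S-digit 1 0 1<B 0<B))
      where
      regroup : ∀ B → B * B ≡ B * (B * 1) * 1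
      regroup = ℕ-Solver.solve-∀

  FourthQuadrant : ℤ[i] → Set
  FourthQuadrant d = ∃[ p ] ∃[ q ] d ≡ (+ suc p , -[1+ q ])

  -- With P = B^(p+q+2), take x = (P - p - 1) + P (B - 1)(B + 1) + P i and y = x + (p + 1) - (q + 1) i
  -- = P B² + (P - q - 1) i. The digits B - 1, B - 1 of x against the single digit 1 of y put S x - S y
  -- in the first quadrant, with imaginary part 2(B - 1).
  merge-fourth-quadrant : Mergeable FourthQuadrant
  merge-fourth-quadrant {U} {u₁} {u₂} compatible u₁∈U u₂∈U (p , q , d≡) =
    Merge-after f-red (Merge-sym (merge-first-quadrant (Reduction.parity f-red) (∈-map⁺ f u₂∈U) (∈-map⁺ f u₁∈U)
      (t + t + Σsq (P ∸ suc p) + Σsq y₂ , B-1 + B-1 , fu₁-fu₂≡)))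
    where
    open ≡-Reasoning
    L = suc p + suc q
    P = B ^ L
    N = 3 + L
    x₁ = (P ∸ suc p) + P * (B-1 + B * B-1)
    y₁ = P * (B * B)
    y₂ = P ∸ suc q
    t = ℕ.pred (B-1 * B-1)
    [B-1]²≡1+t : B-1 * B-1 ≡ suc t
    [B-1]²≡1+t = sym (ℕ.suc-pred (B-1 * B-1) {{ℕ.m*n≢0 B-1 B-1}})
    p+1≤P : suc p ≤ P
    p+1≤P = ℕ.≤-trans (ℕ.m≤m+n (suc p) (suc q)) (ℕ.<⇒≤ (n<B^n L))
    q+1≤P : suc q ≤ P
    q+1≤P = ℕ.≤-trans (ℕ.m≤n+m (suc q) (suc p)) (ℕ.<⇒≤ (n<B^n L))
    x₁+p+1≡y₁ : x₁ + suc p ≡ y₁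
    x₁+p+1≡y₁ = begin
        (P ∸ suc p) + P * (B-1 + B * B-1) + suc p    ≡⟨ regroup (P ∸ suc p) (P * (B-1 + B * B-1)) (suc p) ⟩
        (P ∸ suc p) + suc p + P * (B-1 + B * B-1)    ≡⟨ cong (_+ P * (B-1 + B * B-1)) (ℕ.m∸n+n≡m p+1≤P) ⟩
        P + P * (B-1 + B * B-1)                      ≡⟨ cong (λ b → P + P * (B-1 + b * B-1)) B≡1+B-1 ⟩
        P + P * (B-1 + suc B-1 * B-1)                ≡⟨ expand P B-1 ⟩
        P * (suc B-1 * suc B-1)                      ≡⟨ cong (λ b → P * (b * b)) (sym B≡1+B-1) ⟩
        P * (B * B)                                  ∎
      where
      regroup : ∀ a b c → a + b + c ≡ a + c + b
      regroup = ℕ-Solver.solve-∀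
      expand : ∀ P e → P + P * (e + suc e * e) ≡ P * (suc e * suc e)
      expand = ℕ-Solver.solve-∀
    P≤y₁ : P ≤ y₁
    P≤y₁ = ℕ.m≤m*n P (B * B) {{ℕ.m*n≢0 B B}}
    y₁<B^N : y₁ < B ^ N
    y₁<B^N = subst (y₁ <_) (regroup P B) (ℕ.m<m*n y₁ B {{ℕ.m*n≢0 P (B * B) {{ℕ.m^n≢0 B L}} {{ℕ.m*n≢0 B B}}}} 1<B)
      where
      regroup : ∀ P B → P * (B * B) * B ≡ B * (B * (B * P))
      regroup = ℕ-Solver.solve-∀
    P-even : Even B → Even P
    P-even (k , B≡2k) = k * B ^ (p + suc q) , trans (cong (_* B ^ (p + suc q)) B≡2k) (ℕ.*-distribʳ-+ (B ^ (p + suc q)) k k)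
    d≡y-x : u₂ -ᵍ u₁ ≡ ⟨ y₁ , y₂ ⟩ -ᵍ ⟨ x₁ , P ⟩
    d≡y-x = trans d≡ (cong₂ _,_
      (trans (sym (cancel (+ x₁) (+ suc p))) (cong (λ z → + z ℤ.- + x₁) x₁+p+1≡y₁))
      (trans (sym (cancel′ (+ y₂) (+ suc q))) (cong (λ z → + y₂ ℤ.- + z) (ℕ.m∸n+n≡m q+1≤P))))
      where
      cancel : ∀ x r → (x ℤ.+ r) ℤ.- x ≡ r
      cancel = solve-∀
      cancel′ : ∀ y r → y ℤ.- (y ℤ.+ r) ≡ ℤ.- r
      cancel′ = solve-∀
    stepped = step {u₂ = u₂} compatible u₁∈U N x₁ P y₁ y₂ P-even
                   (ℕ.<-trans (subst (x₁ <_) x₁+p+1≡y₁ (ℕ.m<m+n x₁ (s≤s z≤n))) y₁<B^N)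
                   (ℕ.≤-<-trans P≤y₁ y₁<B^N) y₁<B^N (ℕ.≤-<-trans (ℕ.m∸n≤m P (suc q)) (ℕ.≤-<-trans P≤y₁ y₁<B^N)) d≡y-x
    f = proj₁ stepped
    f-red = proj₁ (proj₂ stepped)
    fu₂-fu₁≡ = proj₂ (proj₂ stepped)
    fu₁-fu₂≡ : f u₁ -ᵍ f u₂ ≡ ⟨ t + t + Σsq (P ∸ suc p) + Σsq y₂ , B-1 + B-1 ⟩
    fu₁-fu₂≡ = begin
        f u₁ -ᵍ f u₂                                  ≡⟨ z-w≡-[w-z] (f u₁) (f u₂) ⟩
        -ᵍ (f u₂ -ᵍ f u₁)                             ≡⟨ cong -ᵍ_ fu₂-fu₁≡ ⟩
        -ᵍ (S B ⟨ y₁ , y₂ ⟩ -ᵍ S B ⟨ x₁ , P ⟩)         ≡⟨ sym (z-w≡-[w-z] (S B ⟨ x₁ , P ⟩) (S B ⟨ y₁ , y₂ ⟩)) ⟩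
        S B ⟨ x₁ , P ⟩ -ᵍ S B ⟨ y₁ , y₂ ⟩
      ≡⟨ cong₂ _-ᵍ_ (S⟨x+P[B²-1],P⟩ L (P ∸ suc p) (ℕ.∸-monoʳ-< (s≤s z≤n) p+1≤P))
                    (S⟨PB²,y⟩ L y₂ (ℕ.∸-monoʳ-< (s≤s z≤n) q+1≤P)) ⟩
        (+ (B-1 * B-1 + B-1 * B-1 + Σsq (P ∸ suc p)) ℤ.- + 1 , + (B-1 + B-1)) -ᵍ (+ 1 ℤ.- + Σsq y₂ , + 0)
      ≡⟨ cong (λ E → (+ (E + E + Σsq (P ∸ suc p)) ℤ.- + 1 , + (B-1 + B-1)) -ᵍ (+ 1 ℤ.- + Σsq y₂ , + 0)) [B-1]²≡1+t ⟩
        (+ (suc t + suc t + Σsq (P ∸ suc p)) ℤ.- + 1 , + (B-1 + B-1)) -ᵍ (+ 1 ℤ.- + Σsq y₂ , + 0)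
      ≡⟨ cong₂ _,_ (regroup (+ t) (+ Σsq (P ∸ suc p)) (+ Σsq y₂)) (ℤ.+-identityʳ _) ⟩
        ⟨ t + t + Σsq (P ∸ suc p) + Σsq y₂ , B-1 + B-1 ⟩
      ∎
      where
      regroup : ∀ T X Y → ((+ 1 ℤ.+ T) ℤ.+ (+ 1 ℤ.+ T) ℤ.+ X ℤ.- + 1) ℤ.- (+ 1 ℤ.- Y) ≡ T ℤ.+ T ℤ.+ X ℤ.+ Y
      regroup = solve-∀

  merge : ∀ {U u₁ u₂} → ParityCompatible U → u₁ ∈ U → u₂ ∈ U → Merge U u₁ u₂
  merge {U} {u₁} {u₂} compatible u₁∈U u₂∈U with u₂ -ᵍ u₁ in d≡
  ... | (+ p , + q) =
    merge-first-quadrant compatible u₁∈U u₂∈U (p , q , d≡)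
  ... | (+ zero , -[1+ q ]) =
    Merge-sym (merge-first-quadrant compatible u₂∈U u₁∈U (0 , suc q , negate-diff u₁ u₂ d≡))
  ... | (+ suc p , -[1+ q ]) =
    merge-fourth-quadrant compatible u₁∈U u₂∈U (p , q , d≡)
  ... | (-[1+ p ] , + zero) =
    Merge-sym (merge-first-quadrant compatible u₂∈U u₁∈U (suc p , 0 , negate-diff u₁ u₂ d≡))
  ... | (-[1+ p ] , + suc q) =
    Merge-sym (merge-fourth-quadrant compatible u₂∈U u₁∈U (p , q , negate-diff u₁ u₂ d≡))
  ... | (-[1+ p ] , -[1+ q ]) =
    Merge-sym (merge-first-quadrant compatible u₂∈U u₁∈U (suc p , suc q , negate-diff u₁ u₂ d≡))

  happy-translate-singleton : ∀ {u} → Evenℤ (proj₂ u) → HasHappyTranslate (u ∷ [])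
  happy-translate-singleton {u} (k , im-u≡2k) with large-happy ∣ proj₂ u ∣
  ... | a′ , W , ∣im-u∣≤W , S⟨a′,2W⟩≡1 with representable-even (+ a′ ℤ.- proj₁ u) W k ∣k∣≤W
    where
    ∣k∣≤W : ∣ k ∣ ≤ W
    ∣k∣≤W = ℕ.≤-trans (∣k∣≤∣k+k∣ k) (subst (_≤ W) (cong ∣_∣ im-u≡2k) ∣im-u∣≤W)
  ... | a , b , b-even , S⟨a,b⟩≡ = a , b , b-even , λ { (here refl) → 1 , trans (cong (S B) S⟨a,b⟩+u≡) S⟨a′,2W⟩≡1 }
    where
    S⟨a,b⟩+u≡ : S B ⟨ a , b ⟩ +ᵍ u ≡ ⟨ a′ , W + W ⟩
    S⟨a,b⟩+u≡ = trans (cong (_+ᵍ u) (trans S⟨a,b⟩≡ (cong (λ i → (+ a′ ℤ.- proj₁ u , + (W + W) ℤ.- i)) (sym im-u≡2k))))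
                      ([z-w]+w≡z ⟨ a′ , W + W ⟩ u)

  ParityCompatible-tail : ∀ {u U} → ParityCompatible (u ∷ U) → ParityCompatible U
  ParityCompatible-tail compatible = record
    { im-even = λ v∈U → im-even (there v∈U)
    ; re-congruent = λ B-odd v∈U w∈U → re-congruent B-odd (there v∈U) (there w∈U) }
    where open ParityCompatible compatible

  HasHappyTranslate-duplicate : ∀ {v w V} → v ≡ w → HasHappyTranslate (w ∷ V) → HasHappyTranslate (v ∷ w ∷ V)
  HasHappyTranslate-duplicate refl (a , b , b-even , happy) = a , b , b-even , λ
    { (here refl) → happy (here refl)
    ; (there v∈) → happy v∈ }

  happy-translate : ∀ n {U} → length U ≡ n → ParityCompatible U → HasHappyTranslate U
  happy-translate _ {[]} _ _ = 0 , 0 , (0 , refl) , λ ()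
  happy-translate _ {u ∷ []} _ compatible = happy-translate-singleton (ParityCompatible.im-even compatible (here refl))
  happy-translate (suc (suc n)) {u₁ ∷ u₂ ∷ us} |U|≡n+2 compatible =
    Reduction.reflect f-red (HasHappyTranslate-duplicate fu₁≡fu₂
      (happy-translate (suc n) {f u₂ ∷ map f us}
        (cong suc (trans (List.length-map f us) (ℕ.suc-injective (ℕ.suc-injective |U|≡n+2))))
        (ParityCompatible-tail (Reduction.parity f-red))))
    where
    merged = merge compatible (here refl) (there (here refl))
    f = proj₁ merged
    f-red = proj₁ (proj₂ merged)
    fu₁≡fu₂ = proj₂ (proj₂ merged)

  S-diagonal-re : ∀ j → proj₁ (S B ⟨ j , j ⟩) ≡ + 0
  S-diagonal-re j = trans (cong proj₁ (S-re-im j j)) (ℤ.+-inverseʳ (+ Σsq j))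

  diagonal-compatible : ∀ m → ParityCompatible (map (λ j → S B ⟨ j , j ⟩) (upTo m))
  diagonal-compatible m = record { im-even = im-even′ ; re-congruent = re-congruent′ }
    where
    im-even′ : ∀ {u} → u ∈ map (λ j → S B ⟨ j , j ⟩) (upTo m) → Evenℤ (proj₂ u)
    im-even′ u∈ with ∈-map⁻ (λ j → S B ⟨ j , j ⟩) u∈
    ... | j , _ , refl = S-im-even j j
    re-congruent′ : Odd B → ∀ {u v} → u ∈ map (λ j → S B ⟨ j , j ⟩) (upTo m) → v ∈ map (λ j → S B ⟨ j , j ⟩) (upTo m) →
                    Evenℤ (proj₁ u ℤ.- proj₁ v)
    re-congruent′ _ u∈ v∈ with ∈-map⁻ (λ j → S B ⟨ j , j ⟩) u∈ | ∈-map⁻ (λ j → S B ⟨ j , j ⟩) v∈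
    ... | j , _ , refl | k , _ , refl = + 0 , cong₂ ℤ._-_ (S-diagonal-re j) (S-diagonal-re k)

  S-translate-diagonal : ∀ L a b j → j < B ^ L →
                         S B (⟨ B ^ L * a , B ^ L * b ⟩ +ᵍ (j ·ᵍ (+ 1 , + 1))) ≡ S B ⟨ a , b ⟩ +ᵍ S B ⟨ j , j ⟩
  S-translate-diagonal L a b j j<B^L =
    trans (cong (S B) (cong₂ _,_ (+j (B ^ L * a)) (+j (B ^ L * b)))) (S-concat L a b j j j<B^L j<B^L)
    where
    +j : ∀ x → + x ℤ.+ + j ℤ.* + 1 ≡ + (j + x)
    +j x = trans (cong (λ t → + x ℤ.+ t) (ℤ.*-identityʳ (+ j))) (cong +_ (ℕ.+-comm x j))

  consecutive-happy : ∀ m → ∃[ z ] ((j : ℕ) → j < m → GaussHappy B (z +ᵍ (j ·ᵍ (+ 1 , + 1))))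
  consecutive-happy m with happy-translate _ refl (diagonal-compatible m)
  ... | a , b , _ , happy = ⟨ B ^ m * a , B ^ m * b ⟩ , λ j j<m →
    GaussHappy-S⁻ _ (subst EventuallyOne (sym (S-translate-diagonal m a b j (ℕ.<-trans j<m (n<B^n m))))
                                          (happy (∈-map⁺ (λ j → S B ⟨ j , j ⟩) (∈-upTo⁺ j<m))))

theorem16 : (B : ℕ) → .{{_ : NonZero B}} → B ≥ 2 →
            (m : ℕ) → m ≥ 1 →
            ∃[ z ] ((j : ℕ) → j < m → GaussHappy B (z +ᵍ (j ·ᵍ (+ 1 , + 1))))
theorem16 B B≥2 m _ = consecutive-happy B B≥2 m
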